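{- Let $M$ be a disconnected binary matroid and let $X$ be a non-empty independent set in $M$. Then the $\Gamma$-extension matroid $M^X$ is connected if and only if every connected component of $M$ intersects $X$.
   Context: Let $M$ be a binary matroid with ground set $S$, represented over $GF(2)$ by a (standard) matrix $A$ whose columns are labeled by $S$. Let $X=\{x_1,\dots,x_m\}\subset S$ be a non-empty independent set of $M$ and let $\Gamma=\{\gamma_1,\dots,\gamma_m\}$ be a set disjoint from $S$. Let $A'$ be obtained from $A$ by adjoining $m$ new columns labeled $\gamma_1,\dots,\gamma_m$, where the column labeled $\gamma_i$ equals the column labeled $x_i$. Let $A^X$ be obtained from $A'$ by adjoining one extra row having entry $1$ in each column labeled $\gamma_i$ ($i=1,\dots,m$) and $0$ elsewhere. The $\Gamma$-extension $M^X$ of $M$ is the vector matroid of $A^X$ over $GF(2)$; its ground set is $S\cup\Gamma$. A matroid is connected if it has no $1$-separation, i.e. no partition of its ground set into two non-empty sets $A,B$ with $r(A)+r(B)=r(M)$; the components of $M$ are its maximal connected restrictions (the classes of the relation "lie in a common circuit or are equal"). Throughout the paper all matroids are assumed loopless and coloopless. -}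

module Defs where

open import Data.Nat using (ℕ; zero; suc; _+_)
open import Data.Bool using (Bool; true; false; _xor_; _∧_; _∨_)
open import Data.Fin using (Fin; zero; suc; splitAt)
open import Data.Fin.Subset using (Subset; _∈_; _⊆_; _⊂_; ⊤; ∁; ∣_∣; Nonempty; Empty; ⁅_⁆)
open import Data.Vec using (lookup; tabulate)
open import Data.Sum using (_⊎_; [_,_])
open import Data.Product using (Σ; ∃; ∃-syntax; _×_)
open import Relation.Binary.PropositionalEquality using (_≡_)
open import Relation.Nullary using (¬_; ⌊_⌋)
open import Data.Fin using (_≟_)

-- A binary matrix with r rows and n columns (column j = element j of the ground set Fin n).
BinMatrix : ℕ → ℕ → Set
BinMatrix r n = Fin r → Fin n → Bool

xorSum : ∀ {n} → (Fin n → Bool) → Bool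
xorSum {zero}  f = false
xorSum {suc n} f = f zero xor xorSum (λ j → f (suc j))

anyB : ∀ {m} → (Fin m → Bool) → Bool
anyB {zero}  f = false
anyB {suc m} f = f zero ∨ anyB (λ j → f (suc j))

colSum : ∀ {r n} → BinMatrix r n → Subset n → Fin r → Bool
colSum A U i = xorSum (λ j → lookup U j ∧ A i j)

-- Vector matroid of A over GF(2): T is independent iff its columns are linearly
-- independent, i.e. no non-empty subset of T has zero column sum.
Independent : ∀ {r n} → BinMatrix r n → Subset n → Set
Independent A T = ∀ U → U ⊆ T → (∀ i → colSum A U i ≡ false) → Empty U

Dependent : ∀ {r n} → BinMatrix r n → Subset n → Set
Dependent A T = ¬ Independent A T

Circuit : ∀ {r n} → BinMatrix r n → Subset n → Set
Circuit A C = Dependent A C × (∀ D → D ⊂ C → Independent A D)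

Basis : ∀ {r n} → BinMatrix r n → Subset n → Set
Basis A B = Independent A B × (∀ I → B ⊂ I → Dependent A I)

IsRank : ∀ {r n} → BinMatrix r n → Subset n → ℕ → Set
IsRank A T k =
  (Σ (Subset _) λ I → I ⊆ T × Independent A I × ∣ I ∣ ≡ k)
  × (∀ I → I ⊆ T → Independent A I → ∣ I ∣ Data.Nat.≤ k)

IsLoop : ∀ {r n} → BinMatrix r n → Fin n → Set
IsLoop A e = Circuit A ⁅ e ⁆

IsColoop : ∀ {r n} → BinMatrix r n → Fin n → Set
IsColoop A e = ∀ B → Basis A B → e ∈ B

Loopless : ∀ {r n} → BinMatrix r n → Set
Loopless A = ∀ e → ¬ IsLoop A e

Coloopless : ∀ {r n} → BinMatrix r n → Set
Coloopless A = ∀ e → ¬ IsColoop A e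

OneSeparation : ∀ {r n} → BinMatrix r n → Subset n → Set
OneSeparation A P =
  Nonempty P × Nonempty (∁ P) ×
  ∃[ ka ] ∃[ kb ] ∃[ k ] (IsRank A P ka × IsRank A (∁ P) kb × IsRank A ⊤ k × ka + kb ≡ k)

Connected : ∀ {r n} → BinMatrix r n → Set
Connected A = ¬ (∃[ P ] OneSeparation A P)

SameComponent : ∀ {r n} → BinMatrix r n → Fin n → Fin n → Set
SameComponent A e f = e ≡ f ⊎ (∃[ C ] (Circuit A C × e ∈ C × f ∈ C))

-- The set X = {x_1, ..., x_m} given by an enumeration x : Fin m → Fin n.
imageSet : ∀ {m n} → (Fin m → Fin n) → Subset n
imageSet x = tabulate (λ s → anyB (λ g → ⌊ x g ≟ s ⌋))

-- Γ-extension matrix A^X: ground set Fin (n + m); elements n + g (g : Fin m) are γ_g,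
-- whose column is that of x_g; an extra row (row 0) is 1 exactly on the γ columns.
gammaExt : ∀ {r n m} → BinMatrix r n → (Fin m → Fin n) → BinMatrix (suc r) (n + m)
gammaExt {n = n} A x zero    j = [ (λ _ → false) , (λ _ → true) ] (splitAt n j)
gammaExt {n = n} A x (suc i) j = [ (λ s → A i s) , (λ g → A i (x g)) ] (splitAt n j)

module Submission where

-- Everything is done by GF(2) linear algebra on column sums.  A cycle is a set of columns
-- summing to zero, so a set is independent iff it contains no non-empty cycle.
--
-- For the extension B we compute its column sums.  (⇒) If the component K of e misses X,
-- every cycle of B projects to a cycle of A, which restricts to K; hence the copy of K is a
-- 1-separation of B.  (⇐) Circuits of A lift to B, and for g ≢ g' the set
-- {x g, x g', γ g, γ g'} is a circuit of B, so every element is on the side of x g₀ of any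
-- 1-separation; if |X| = 1 the hypothesis would instead make M itself connected.

open import Defs
open import Data.Nat using (ℕ; zero; suc; _+_; _∸_; _<_; _≤_; s≤s; z≤n)
import Data.Nat.Properties as ℕ
open import Data.Nat.Induction using (<-wellFounded)
open import Data.Bool using (Bool; true; false; not; _∧_; _∨_; _xor_; if_then_else_) renaming (_≟_ to _≟ᵇ_)
open import Data.Bool.Properties
  using ( xor-assoc; xor-identityʳ; ∧-distribˡ-xor; ∧-distribʳ-xor
        ; ∧-assoc; ∧-zeroʳ; ∧-identityʳ; ∨-zeroʳ; xor-∧-commutativeRing)
open import Algebra.Bundles using (CommutativeRing)
open import Algebra.Properties.CommutativeSemigroup
  (CommutativeRing.+-commutativeSemigroup xor-∧-commutativeRing) using (interchange)
open import Data.Fin using (Fin; zero; suc; _≟_; splitAt; _↑ˡ_; _↑ʳ_; fromℕ<)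
open import Data.Fin.Properties
  using ( any?; all?; suc-injective; splitAt-↑ˡ; splitAt-↑ʳ; splitAt⁻¹-↑ˡ; splitAt⁻¹-↑ʳ
        ; ↑ˡ-injective; ↑ʳ-injective)
open import Data.Fin.Subset
  using (Subset; _∈_; _∉_; _⊆_; _⊂_; ⊤; ⊥; ∁; _∩_; _∪_; ∣_∣; Nonempty; Empty; ⁅_⁆)
open import Data.Fin.Subset.Properties
  using ( _∈?_; _⊆?_; _⊂?_; anySubset?; nonempty?; Empty-unique; ⊆-antisym; ⊥⊆; ∉⊥; ∈⊤
        ; ∣p∣≤n; ∣⊥∣≡0; ∣⁅x⁆∣≡1; p⊂q⇒∣p∣<∣q∣; x∈⁅x⁆; x∈⁅y⁆⇒x≡y; x≢y⇒x∉⁅y⁆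
        ; p∩q⊆p; p∩q⊆q; x∈p∩q⁺; x∈p∩q⁻; x∈p∪q⁺; x∈p∪q⁻; x∈∁p⇒x∉p; x∉p⇒x∈∁p)
open import Data.Vec using (_∷_; []; lookup; zipWith; tabulate)
open import Data.Vec.Properties
  using ( lookup-zipWith; lookup-map; lookup∘tabulate; tabulate∘lookup; tabulate-cong
        ; []=⇒lookup; lookup⇒[]=)
open import Data.Product using (∃-syntax; _×_; _,_; proj₁; proj₂)
open import Data.Sum using (_⊎_; inj₁; inj₂; [_,_]′)
open import Data.Empty using (⊥-elim) renaming (⊥ to False)
open import Function using (_∘′_; _on_)
open import Function.Definitions using (Injective)
open import Function.Bundles using (_⇔_; mk⇔)
open import Induction.WellFounded using (WellFounded; Acc; acc; module Subrelation)
import Relation.Binary.Construct.On as On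
open import Relation.Binary.PropositionalEquality
open import Relation.Nullary using (¬_; Dec; yes; no; ⌊_⌋)
open import Relation.Nullary.Decidable using (_×-dec_; _⊎-dec_; ¬?; dec-true; isYes≗does)

true≢false : ¬ true ≡ false
true≢false ()

xor-false⇒≡ : ∀ a b → a xor b ≡ false → a ≡ b
xor-false⇒≡ true  true  _ = refl
xor-false⇒≡ false false _ = refl

⌊⌋-true : ∀ {P : Set} (d : Dec P) → P → ⌊ d ⌋ ≡ true
⌊⌋-true d p = trans (isYes≗does d) (dec-true d p)

∧-not≡xor : ∀ u v → (v ≡ true → u ≡ true) → u ∧ not v ≡ u xor v
∧-not≡xor u     false _   = trans (∧-identityʳ u) (sym (xor-identityʳ u))
∧-not≡xor true  true  _   = refl
∧-not≡xor false true  v⇒u = ⊥-elim (true≢false (sym (v⇒u refl)))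

xorSum-cong : ∀ {n} {f g : Fin n → Bool} → (∀ j → f j ≡ g j) → xorSum f ≡ xorSum g
xorSum-cong {zero}  h = refl
xorSum-cong {suc n} h = cong₂ _xor_ (h zero) (xorSum-cong (λ j → h (suc j)))

xorSum-zero : ∀ {n} (f : Fin n → Bool) → (∀ j → f j ≡ false) → xorSum f ≡ false
xorSum-zero {zero}  f h = refl
xorSum-zero {suc n} f h = cong₂ _xor_ (h zero) (xorSum-zero _ (λ j → h (suc j)))

xorSum-xor : ∀ {n} (f g : Fin n → Bool) →
  xorSum (λ j → f j xor g j) ≡ xorSum f xor xorSum g
xorSum-xor {zero}  f g = refl
xorSum-xor {suc n} f g =
  trans (cong ((f zero xor g zero) xor_) (xorSum-xor (λ j → f (suc j)) (λ j → g (suc j))))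
        (interchange (f zero) (g zero) _ _)

xorSum-∧ˡ : ∀ {n} b (f : Fin n → Bool) → xorSum (λ j → b ∧ f j) ≡ b ∧ xorSum f
xorSum-∧ˡ {zero}  b f = sym (∧-zeroʳ b)
xorSum-∧ˡ {suc n} b f =
  trans (cong ((b ∧ f zero) xor_) (xorSum-∧ˡ b (λ j → f (suc j)))) (sym (∧-distribˡ-xor b (f zero) _))

xorSum-∧ʳ : ∀ {n} (f : Fin n → Bool) b → xorSum (λ j → f j ∧ b) ≡ xorSum f ∧ b
xorSum-∧ʳ {zero}  f b = refl
xorSum-∧ʳ {suc n} f b =
  trans (cong ((f zero ∧ b) xor_) (xorSum-∧ʳ (λ j → f (suc j)) b)) (sym (∧-distribʳ-xor b (f zero) _))

xorSum-single : ∀ {n} (f : Fin n → Bool) p → (∀ j → ¬ j ≡ p → f j ≡ false) → xorSum f ≡ f p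
xorSum-single {suc n} f zero h =
  trans (cong (f zero xor_) (xorSum-zero _ (λ j → h (suc j) (λ ())))) (xor-identityʳ _)
xorSum-single {suc n} f (suc p) h =
  trans (cong (_xor xorSum (λ j → f (suc j))) (h zero (λ ())))
        (xorSum-single (λ j → f (suc j)) p (λ j j≢p → h (suc j) (λ e → j≢p (suc-injective e))))

xorSum-pair : ∀ {n} (f : Fin n → Bool) p q → ¬ p ≡ q →
  (∀ j → ¬ j ≡ p → ¬ j ≡ q → f j ≡ false) → xorSum f ≡ f p xor f q
xorSum-pair f p q p≢q h = begin
  xorSum f                           ≡⟨ xorSum-cong split ⟩
  xorSum (λ j → onP j xor onQ j)     ≡⟨ xorSum-xor onP onQ ⟩
  xorSum onP xor xorSum onQ          ≡⟨ cong₂ _xor_ (xorSum-single onP p (λ j j≢p → onP-off j j≢p))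
                                                    (xorSum-single onQ q (λ j j≢q → onQ-off j j≢q)) ⟩
  onP p xor onQ q                    ≡⟨ cong₂ _xor_ (onP-at p refl) (onQ-at q refl) ⟩
  f p xor f q                        ∎
  where
  open ≡-Reasoning
  onP onQ : _ → Bool
  onP j = ⌊ j ≟ p ⌋ ∧ f j
  onQ j = ⌊ j ≟ q ⌋ ∧ f j
  onP-off : ∀ j → ¬ j ≡ p → onP j ≡ false
  onP-off j j≢p with j ≟ p
  ... | yes e = ⊥-elim (j≢p e)
  ... | no _  = refl
  onQ-off : ∀ j → ¬ j ≡ q → onQ j ≡ false
  onQ-off j j≢q with j ≟ q
  ... | yes e = ⊥-elim (j≢q e)
  ... | no _  = refl
  onP-at : ∀ j → j ≡ p → onP j ≡ f j
  onP-at j j≡p with j ≟ p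
  ... | yes _ = refl
  ... | no j≢p = ⊥-elim (j≢p j≡p)
  onQ-at : ∀ j → j ≡ q → onQ j ≡ f j
  onQ-at j j≡q with j ≟ q
  ... | yes _ = refl
  ... | no j≢q = ⊥-elim (j≢q j≡q)
  split : ∀ j → f j ≡ onP j xor onQ j
  split j with j ≟ p | j ≟ q
  ... | yes refl | yes refl = ⊥-elim (p≢q refl)
  ... | yes _    | no _     = sym (xor-identityʳ (f j))
  ... | no _     | yes _    = refl
  ... | no j≢p   | no j≢q   = h j j≢p j≢q

xorSum-true : ∀ {n} (f : Fin n → Bool) → xorSum f ≡ true → ∃[ j ] f j ≡ true
xorSum-true {suc n} f h with f zero in eq
... | true  = zero , eq
... | false = let (j , fj) = xorSum-true (λ j → f (suc j)) h in suc j , fj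

xorSum-+ : ∀ n {m} (f : Fin (n + m) → Bool) →
  xorSum f ≡ xorSum (λ s → f (s ↑ˡ m)) xor xorSum (λ g → f (n ↑ʳ g))
xorSum-+ zero    f = refl
xorSum-+ (suc n) f =
  trans (cong (f zero xor_) (xorSum-+ n (λ j → f (suc j)))) (sym (xor-assoc (f zero) _ _))

xorSum-swap : ∀ {n m} (f : Fin n → Fin m → Bool) →
  xorSum (λ s → xorSum (λ g → f s g)) ≡ xorSum (λ g → xorSum (λ s → f s g))
xorSum-swap {zero} {m} f = sym (xorSum-zero {m} _ (λ _ → refl))
xorSum-swap {suc n} f =
  trans (cong (xorSum (f zero) xor_) (xorSum-swap (λ s → f (suc s))))
        (sym (xorSum-xor (f zero) (λ g → xorSum (λ s → f (suc s) g))))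

infixl 9 _!_
_!_ : ∀ {n} → Subset n → Fin n → Bool
U ! j = lookup U j

∈⇒! : ∀ {n} {U : Subset n} {j} → j ∈ U → U ! j ≡ true
∈⇒! = []=⇒lookup

!⇒∈ : ∀ {n} {U : Subset n} {j} → U ! j ≡ true → j ∈ U
!⇒∈ {U = U} {j} = lookup⇒[]= j U

∉⇒! : ∀ {n} {U : Subset n} {j} → j ∉ U → U ! j ≡ false
∉⇒! {U = U} {j} j∉U with U ! j in eq
... | true  = ⊥-elim (j∉U (!⇒∈ eq))
... | false = refl

!⇒∉ : ∀ {n} {U : Subset n} {j} → U ! j ≡ false → j ∉ U
!⇒∉ U!j≡false j∈U = true≢false (trans (sym (∈⇒! j∈U)) U!j≡false)

subset-ext : ∀ {n} {U V : Subset n} → (∀ j → U ! j ≡ V ! j) → U ≡ V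
subset-ext {U = U} {V} h = trans (sym (tabulate∘lookup U)) (trans (tabulate-cong h) (tabulate∘lookup V))

infixl 6 _∖_ _⊕_
_∖_ : ∀ {n} → Subset n → Subset n → Subset n
U ∖ V = U ∩ ∁ V

_⊕_ : ∀ {n} → Subset n → Subset n → Subset n
U ⊕ V = zipWith _xor_ U V

!-∩ : ∀ {n} (U V : Subset n) j → (U ∩ V) ! j ≡ U ! j ∧ V ! j
!-∩ U V j = lookup-zipWith _∧_ j U V

!-∖ : ∀ {n} (U V : Subset n) j → (U ∖ V) ! j ≡ U ! j ∧ not (V ! j)
!-∖ U V j = trans (lookup-zipWith _∧_ j U (∁ V)) (cong (U ! j ∧_) (lookup-map j not V))

!-⊕ : ∀ {n} (U V : Subset n) j → (U ⊕ V) ! j ≡ U ! j xor V ! j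
!-⊕ U V j = lookup-zipWith _xor_ j U V

∈∖⁺ : ∀ {n} {U V : Subset n} {j} → j ∈ U → j ∉ V → j ∈ U ∖ V
∈∖⁺ j∈U j∉V = x∈p∩q⁺ (j∈U , x∉p⇒x∈∁p j∉V)

∈∖⁻ : ∀ {n} (U V : Subset n) {j} → j ∈ U ∖ V → j ∈ U × j ∉ V
∈∖⁻ U V j∈ = let (j∈U , j∈∁V) = x∈p∩q⁻ U (∁ V) j∈ in j∈U , x∈∁p⇒x∉p j∈∁V

∖⊆ : ∀ {n} (U V : Subset n) → U ∖ V ⊆ U
∖⊆ U V j∈ = proj₁ (∈∖⁻ U V j∈)

∈⊕⁻ : ∀ {n} (U V : Subset n) {j} → j ∈ U ⊕ V → (j ∈ U × j ∉ V) ⊎ (j ∉ U × j ∈ V)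
∈⊕⁻ U V {j} j∈ with U ! j in eu | V ! j in ev | trans (sym (!-⊕ U V j)) (∈⇒! j∈)
... | true  | false | _ = inj₁ (!⇒∈ eu , !⇒∉ ev)
... | false | true  | _ = inj₂ (!⇒∉ eu , !⇒∈ ev)

∈⊕⁺ˡ : ∀ {n} {U V : Subset n} {j} → j ∈ U → j ∉ V → j ∈ U ⊕ V
∈⊕⁺ˡ {U = U} {V} {j} j∈U j∉V = !⇒∈ (trans (!-⊕ U V j) (cong₂ _xor_ (∈⇒! j∈U) (∉⇒! j∉V)))

∈⊕⁺ʳ : ∀ {n} {U V : Subset n} {j} → j ∉ U → j ∈ V → j ∈ U ⊕ V
∈⊕⁺ʳ {U = U} {V} {j} j∉U j∈V = !⇒∈ (trans (!-⊕ U V j) (cong₂ _xor_ (∉⇒! j∉U) (∈⇒! j∈V)))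

∈⊕-∉ʳ : ∀ {n} (U V : Subset n) {j} → j ∈ U ⊕ V → j ∉ V → j ∈ U
∈⊕-∉ʳ U V j∈ j∉V = [ proj₁ , (λ (_ , j∈V) → ⊥-elim (j∉V j∈V)) ]′ (∈⊕⁻ U V j∈)

∉⊕-both : ∀ {n} (U V : Subset n) {j} → j ∈ U → j ∈ V → j ∉ U ⊕ V
∉⊕-both U V j∈U j∈V j∈ =
  [ (λ (_ , j∉V) → j∉V j∈V) , (λ (j∉U , _) → j∉U j∈U) ]′ (∈⊕⁻ U V j∈)

⁅⁆⊆ : ∀ {n} {I : Subset n} {y} → y ∈ I → ⁅ y ⁆ ⊆ I
⁅⁆⊆ {I = I} y∈I k∈ = subst (_∈ I) (sym (x∈⁅y⁆⇒x≡y _ k∈)) y∈I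

∈⁅⁆-transfer : ∀ {n} (U : Subset n) {y j} → j ∈ ⁅ y ⁆ → j ∈ U → y ∈ U
∈⁅⁆-transfer U j∈y j∈U = subst (_∈ U) (x∈⁅y⁆⇒x≡y _ j∈y) j∈U

∪⁅⁆⊆ : ∀ {n} {I T : Subset n} {y} → I ⊆ T → y ∈ T → I ∪ ⁅ y ⁆ ⊆ T
∪⁅⁆⊆ {I = I} {y = y} I⊆T y∈T j∈ = [ I⊆T , ⁅⁆⊆ y∈T ]′ (x∈p∪q⁻ I ⁅ y ⁆ j∈)

∈∪⁅⁆⁻ : ∀ {n} (I : Subset n) {y j} → j ∈ I ∪ ⁅ y ⁆ → j ∉ ⁅ y ⁆ → j ∈ I
∈∪⁅⁆⁻ I {y} j∈ j∉y = [ (λ j∈I → j∈I) , (λ j∈y → ⊥-elim (j∉y j∈y)) ]′ (x∈p∪q⁻ I ⁅ y ⁆ j∈)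

∣∣-split : ∀ {n} (U P : Subset n) → ∣ U ∣ ≡ ∣ U ∩ P ∣ + ∣ U ∖ P ∣
∣∣-split []           []           = refl
∣∣-split (true  ∷ U) (true  ∷ P) = cong suc (∣∣-split U P)
∣∣-split (true  ∷ U) (false ∷ P) = trans (cong suc (∣∣-split U P)) (sym (ℕ.+-suc _ _))
∣∣-split (false ∷ U) (_     ∷ P) = ∣∣-split U P

∣∣-remove : ∀ {n} {U : Subset n} {j} → j ∈ U → ∣ U ∣ ≡ suc ∣ U ∖ ⁅ j ⁆ ∣
∣∣-remove {U = U} {j} j∈U = begin
  ∣ U ∣                            ≡⟨ ∣∣-split U ⁅ j ⁆ ⟩
  ∣ U ∩ ⁅ j ⁆ ∣ + ∣ U ∖ ⁅ j ⁆ ∣    ≡⟨ cong (λ W → ∣ W ∣ + ∣ U ∖ ⁅ j ⁆ ∣) U∩j≡j ⟩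
  ∣ ⁅ j ⁆ ∣ + ∣ U ∖ ⁅ j ⁆ ∣        ≡⟨ cong (_+ ∣ U ∖ ⁅ j ⁆ ∣) (∣⁅x⁆∣≡1 j) ⟩
  suc ∣ U ∖ ⁅ j ⁆ ∣                ∎
  where
  open ≡-Reasoning
  U∩j≡j : U ∩ ⁅ j ⁆ ≡ ⁅ j ⁆
  U∩j≡j = ⊆-antisym (p∩q⊆q U ⁅ j ⁆) (λ k∈ → x∈p∩q⁺ (⁅⁆⊆ j∈U k∈ , k∈))

∣∣≡0⇒empty : ∀ {n} (U : Subset n) → ∣ U ∣ ≡ 0 → Empty U
∣∣≡0⇒empty U ∣U∣≡0 (j , j∈U) = ℕ.0≢1+n (trans (sym ∣U∣≡0) (∣∣-remove j∈U))

empty⇒∣∣≡0 : ∀ {n} (U : Subset n) → Empty U → ∣ U ∣ ≡ 0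
empty⇒∣∣≡0 {n} U em = trans (cong ∣_∣ (Empty-unique em)) (∣⊥∣≡0 n)

∣∣-add : ∀ {n} (I : Subset n) {y} → y ∉ I → ∣ I ∪ ⁅ y ⁆ ∣ ≡ suc ∣ I ∣
∣∣-add I {y} y∉I =
  trans (∣∣-remove {U = I ∪ ⁅ y ⁆} (x∈p∪q⁺ (inj₂ (x∈⁅x⁆ y)))) (cong (suc ∘′ ∣_∣) I∪y∖y≡I)
  where
  I∪y∖y≡I : (I ∪ ⁅ y ⁆) ∖ ⁅ y ⁆ ≡ I
  I∪y∖y≡I = ⊆-antisym
    (λ j∈ → let (j∈I∪y , j∉y) = ∈∖⁻ (I ∪ ⁅ y ⁆) ⁅ y ⁆ j∈ in ∈∪⁅⁆⁻ I j∈I∪y j∉y)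
    (λ j∈I → ∈∖⁺ (x∈p∪q⁺ (inj₁ j∈I)) (λ j∈y → y∉I (∈⁅⁆-transfer I j∈y j∈I)))

∣∣≡suc⇒nonempty : ∀ {n} (U : Subset n) {k} → ∣ U ∣ ≡ suc k → Nonempty U
∣∣≡suc⇒nonempty U ∣U∣≡1+k with nonempty? U
... | yes ne = ne
... | no  em = ⊥-elim (ℕ.0≢1+n (trans (sym (empty⇒∣∣≡0 U em)) ∣U∣≡1+k))


Cycle : ∀ {r n} → BinMatrix r n → Subset n → Set
Cycle A U = ∀ i → colSum A U i ≡ false

colSum-⊕ : ∀ {r n} (A : BinMatrix r n) (U V : Subset n) i →
  colSum A (U ⊕ V) i ≡ colSum A U i xor colSum A V i
colSum-⊕ A U V i = begin
  xorSum (λ j → (U ⊕ V) ! j ∧ A i j)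
    ≡⟨ xorSum-cong (λ j → trans (cong (_∧ A i j) (!-⊕ U V j)) (∧-distribʳ-xor (A i j) (U ! j) (V ! j))) ⟩
  xorSum (λ j → (U ! j ∧ A i j) xor (V ! j ∧ A i j))
    ≡⟨ xorSum-xor (λ j → U ! j ∧ A i j) (λ j → V ! j ∧ A i j) ⟩
  colSum A U i xor colSum A V i ∎
  where open ≡-Reasoning

cycle-⊕ : ∀ {r n} (A : BinMatrix r n) (U V : Subset n) → Cycle A U → Cycle A V → Cycle A (U ⊕ V)
cycle-⊕ A U V cU cV i = trans (colSum-⊕ A U V i) (cong₂ _xor_ (cU i) (cV i))

cycle-empty : ∀ {r n} (A : BinMatrix r n) {U : Subset n} → Empty U → Cycle A U
cycle-empty A em i = xorSum-zero _ (λ j → cong (_∧ A i j) (∉⇒! (λ j∈ → em (j , j∈))))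

colSum-⁅⁆ : ∀ {r n} (A : BinMatrix r n) j i → colSum A ⁅ j ⁆ i ≡ A i j
colSum-⁅⁆ A j i =
  trans (xorSum-single _ j (λ k k≢j → cong (_∧ A i k) (∉⇒! (x≢y⇒x∉⁅y⁆ k≢j))))
        (cong (_∧ A i j) (∈⇒! (x∈⁅x⁆ j)))

∖≡⊕ : ∀ {n} {U V : Subset n} → V ⊆ U → U ∖ V ≡ U ⊕ V
∖≡⊕ {U = U} {V} V⊆U = subset-ext λ j → begin
  (U ∖ V) ! j            ≡⟨ !-∖ U V j ⟩
  U ! j ∧ not (V ! j)    ≡⟨ ∧-not≡xor (U ! j) (V ! j) (λ v → ∈⇒! (V⊆U (!⇒∈ v))) ⟩
  U ! j xor V ! j        ≡⟨ sym (!-⊕ U V j) ⟩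
  (U ⊕ V) ! j            ∎
  where open ≡-Reasoning

cycle-∖ : ∀ {r n} (A : BinMatrix r n) (U V : Subset n) → V ⊆ U → Cycle A U → Cycle A V → Cycle A (U ∖ V)
cycle-∖ A U V V⊆U cU cV rewrite ∖≡⊕ {U = U} {V} V⊆U = cycle-⊕ A U V cU cV

colSum-remove : ∀ {r n} (A : BinMatrix r n) {U : Subset n} {j} → j ∈ U →
  ∀ i → colSum A (U ∖ ⁅ j ⁆) i ≡ colSum A U i xor A i j
colSum-remove A {U} {j} j∈U i = begin
  colSum A (U ∖ ⁅ j ⁆) i              ≡⟨ cong (λ W → colSum A W i) (∖≡⊕ {U = U} (⁅⁆⊆ j∈U)) ⟩
  colSum A (U ⊕ ⁅ j ⁆) i              ≡⟨ colSum-⊕ A U ⁅ j ⁆ i ⟩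
  colSum A U i xor colSum A ⁅ j ⁆ i   ≡⟨ cong (colSum A U i xor_) (colSum-⁅⁆ A j i) ⟩
  colSum A U i xor A i j              ∎
  where open ≡-Reasoning

cycle? : ∀ {r n} (A : BinMatrix r n) U → Dec (Cycle A U)
cycle? A U = all? (λ i → colSum A U i ≟ᵇ false)

HasCycle : ∀ {r n} → BinMatrix r n → Subset n → Set
HasCycle A T = ∃[ U ] (U ⊆ T × Cycle A U × Nonempty U)

hasCycle? : ∀ {r n} (A : BinMatrix r n) T → Dec (HasCycle A T)
hasCycle? A T = anySubset? (λ U → (U ⊆? T) ×-dec (cycle? A U ×-dec nonempty? U))

independent? : ∀ {r n} (A : BinMatrix r n) T → Dec (Independent A T)
independent? A T with hasCycle? A T
... | yes (U , U⊆T , cU , neU) = no (λ ind → ind U U⊆T cU neU)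
... | no  noCycle              = yes (λ U U⊆T cU neU → noCycle (U , U⊆T , cU , neU))

dependent⇒cycle : ∀ {r n} {A : BinMatrix r n} {T} → Dependent A T → HasCycle A T
dependent⇒cycle {A = A} {T} dep with hasCycle? A T
... | yes c       = c
... | no  noCycle = ⊥-elim (dep (λ U U⊆T cU neU → noCycle (U , U⊆T , cU , neU)))

independent-⊆ : ∀ {r n} {A : BinMatrix r n} {S T} → S ⊆ T → Independent A T → Independent A S
independent-⊆ S⊆T indT U U⊆S = indT U (λ j∈ → S⊆T (U⊆S j∈))

zero-column : ∀ {r n} (A : BinMatrix r n) {J} j → Independent A J → j ∈ J → (∀ i → A i j ≡ false) → False
zero-column A {J} j indJ j∈J zero-col =
  indJ ⁅ j ⁆ (⁅⁆⊆ j∈J) (λ i → trans (colSum-⁅⁆ A j i) (zero-col i)) (j , x∈⁅x⁆ j)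

independent-pair : ∀ {r n} (A : BinMatrix r n) {I p q} → Independent A I → p ∈ I → q ∈ I → ¬ p ≡ q →
  ∀ α β → (∀ i → (α ∧ A i p) xor (β ∧ A i q) ≡ false) → α ≡ false × β ≡ false
independent-pair A         _    _   _   _   false false _   = refl , refl
independent-pair A         indI p∈I _   _   true  false rel =
  ⊥-elim (zero-column A _ indI p∈I (λ i → trans (sym (xor-identityʳ _)) (rel i)))
independent-pair A         indI _   q∈I _   false true  rel = ⊥-elim (zero-column A _ indI q∈I rel)
independent-pair A {I} {p} {q} indI p∈I q∈I p≢q true true rel =
  ⊥-elim (indI (⁅ p ⁆ ⊕ ⁅ q ⁆) sub
    (λ i → trans (colSum-⊕ A ⁅ p ⁆ ⁅ q ⁆ i)
                 (trans (cong₂ _xor_ (colSum-⁅⁆ A p i) (colSum-⁅⁆ A q i)) (rel i)))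
    (p , ∈⊕⁺ˡ (x∈⁅x⁆ p) (x≢y⇒x∉⁅y⁆ p≢q)))
  where
  sub : ⁅ p ⁆ ⊕ ⁅ q ⁆ ⊆ I
  sub j∈ = [ (λ (j∈p , _) → ⁅⁆⊆ p∈I j∈p) , (λ (_ , j∈q) → ⁅⁆⊆ q∈I j∈q) ]′ (∈⊕⁻ ⁅ p ⁆ ⁅ q ⁆ j∈)

column : ∀ {r n} → BinMatrix r n → Fin n → Fin r → Bool
column A e i = A i e

InSpan : ∀ {r n} → BinMatrix r n → Subset n → (Fin r → Bool) → Set
InSpan A L v = ∃[ U ] (U ⊆ L × (∀ i → colSum A U i ≡ v i))

inSpan? : ∀ {r n} (A : BinMatrix r n) L e → Dec (InSpan A L (column A e))
inSpan? A L e = anySubset? (λ U → (U ⊆? L) ×-dec all? (λ i → colSum A U i ≟ᵇ A i e))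

inSpan-self : ∀ {r n} (A : BinMatrix r n) {I} y → y ∈ I → InSpan A I (column A y)
inSpan-self A y y∈I = ⁅ y ⁆ , ⁅⁆⊆ y∈I , colSum-⁅⁆ A y

independent-∪ : ∀ {r n} (A : BinMatrix r n) {I} y → Independent A I → ¬ InSpan A I (column A y) →
  Independent A (I ∪ ⁅ y ⁆)
independent-∪ A {I} y indI y∉span V V⊆ cV neV with y ∈? V
... | yes y∈V = y∉span (V ∖ ⁅ y ⁆ , V∖y⊆I , λ i → trans (colSum-remove A y∈V i) (cong (_xor A i y) (cV i)))
  where
  V∖y⊆I : V ∖ ⁅ y ⁆ ⊆ I
  V∖y⊆I j∈ = let (j∈V , j∉y) = ∈∖⁻ V ⁅ y ⁆ j∈ in ∈∪⁅⁆⁻ I (V⊆ j∈V) j∉y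
... | no y∉V = indI V V⊆I cV neV
  where
  V⊆I : V ⊆ I
  V⊆I j∈V = ∈∪⁅⁆⁻ I (V⊆ j∈V) (λ j∈y → y∉V (∈⁅⁆-transfer V j∈y j∈V))

Represents : ∀ {r p q} → BinMatrix r p → BinMatrix r q → Subset p → Subset q → (Fin p → Subset q) → Set
Represents A W J L R = ∀ j → j ∈ J → R j ⊆ L × (∀ i → colSum W (R j) i ≡ A i j)

-- One pivoting step of the exchange argument: eliminate the column l of W, used by the
-- representation of column j0, from all representations by adding column j0 to A.
module Pivot {r p q} (A : BinMatrix r p) (W : BinMatrix r q) (R : Fin p → Subset q) (j0 : Fin p) (l : Fin q) where

  uses : Fin p → Bool
  uses j = R j ! l

  A' : BinMatrix r p
  A' i j = A i j xor (uses j ∧ A i j0)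

  R' : Fin p → Subset q
  R' j = if uses j then R j ⊕ R j0 else R j

  represents : ∀ {J L} → l ∈ R j0 → j0 ∈ J → Represents A W J L R →
    Represents A' W (J ∖ ⁅ j0 ⁆) (L ∖ ⁅ l ⁆) R'
  represents {J} {L} l∈R0 j0∈J rep j j∈ with uses j in u | rep j (∖⊆ J ⁅ j0 ⁆ j∈) | rep j0 j0∈J
  ... | true | (Rj⊆L , colRj) | (R0⊆L , colR0) = sub , λ i →
          trans (colSum-⊕ W (R j) (R j0) i) (cong₂ _xor_ (colRj i) (colR0 i))
    where
    sub : R j ⊕ R j0 ⊆ L ∖ ⁅ l ⁆
    sub y∈ with ∈⊕⁻ (R j) (R j0) y∈
    ... | inj₁ (y∈Rj , y∉R0) =
          ∈∖⁺ (Rj⊆L y∈Rj) (λ y∈l → y∉R0 (⁅⁆⊆ l∈R0 y∈l))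
    ... | inj₂ (y∉Rj , y∈R0) =
          ∈∖⁺ (R0⊆L y∈R0) (λ y∈l → y∉Rj (⁅⁆⊆ (!⇒∈ u) y∈l))
  ... | false | (Rj⊆L , colRj) | _ = sub , λ i → trans (colRj i) (sym (xor-identityʳ _))
    where
    sub : R j ⊆ L ∖ ⁅ l ⁆
    sub y∈ = ∈∖⁺ (Rj⊆L y∈) (λ y∈l → !⇒∉ u (∈⁅⁆-transfer (R j) y∈l y∈))

  colSum-A' : ∀ V b → xorSum (λ j → V ! j ∧ uses j) ≡ b →
    ∀ i → colSum A' V i ≡ colSum A V i xor (b ∧ A i j0)
  colSum-A' V b uses≡b i = begin
    xorSum (λ j → V ! j ∧ (A i j xor (uses j ∧ A i j0)))
      ≡⟨ xorSum-cong (λ j → trans (∧-distribˡ-xor (V ! j) _ _)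
                                  (cong ((V ! j ∧ A i j) xor_) (sym (∧-assoc (V ! j) (uses j) (A i j0))))) ⟩
    xorSum (λ j → (V ! j ∧ A i j) xor ((V ! j ∧ uses j) ∧ A i j0))
      ≡⟨ xorSum-xor (λ j → V ! j ∧ A i j) (λ j → (V ! j ∧ uses j) ∧ A i j0) ⟩
    colSum A V i xor xorSum (λ j → (V ! j ∧ uses j) ∧ A i j0)
      ≡⟨ cong (colSum A V i xor_) (xorSum-∧ʳ (λ j → V ! j ∧ uses j) (A i j0)) ⟩
    colSum A V i xor (xorSum (λ j → V ! j ∧ uses j) ∧ A i j0)
      ≡⟨ cong (λ b → colSum A V i xor (b ∧ A i j0)) uses≡b ⟩
    colSum A V i xor (b ∧ A i j0) ∎
    where open ≡-Reasoning

  -- A cycle V of A' avoiding j0 yields the cycle V or V ⊕ {j0} of A.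
  independent : ∀ {J} → j0 ∈ J → Independent A J → Independent A' (J ∖ ⁅ j0 ⁆)
  independent {J} j0∈J indJ V V⊆ cV (v , v∈V) with xorSum (λ j → V ! j ∧ uses j) in t
  ... | false = indJ V (λ k∈ → ∖⊆ J ⁅ j0 ⁆ (V⊆ k∈))
                  (λ i → trans (sym (xor-identityʳ _)) (trans (sym (colSum-A' V false t i)) (cV i)))
                  (v , v∈V)
  ... | true  = indJ (V ⊕ ⁅ j0 ⁆) sub
                  (λ i → trans (colSum-⊕ A V ⁅ j0 ⁆ i)
                           (trans (cong (colSum A V i xor_) (colSum-⁅⁆ A j0 i))
                                  (trans (sym (colSum-A' V true t i)) (cV i))))
                  (v , ∈⊕⁺ˡ v∈V (proj₂ (∈∖⁻ J ⁅ j0 ⁆ (V⊆ v∈V))))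
    where
    sub : V ⊕ ⁅ j0 ⁆ ⊆ J
    sub k∈ with ∈⊕⁻ V ⁅ j0 ⁆ k∈
    ... | inj₁ (k∈V , _) = ∖⊆ J ⁅ j0 ⁆ (V⊆ k∈V)
    ... | inj₂ (_ , k∈j0) = ⁅⁆⊆ j0∈J k∈j0

-- Steinitz exchange: an independent set whose columns are sums of columns of W indexed
-- by L has at most |L| elements.  Induction on |L|, pivoting away one element of L.
exchange : ∀ {r p q} k (A : BinMatrix r p) (W : BinMatrix r q) J L R →
  ∣ L ∣ ≡ k → Independent A J → Represents A W J L R → ∣ J ∣ ≤ k
exchange zero A W J L R ∣L∣≡0 indJ rep = ℕ.≤-reflexive (empty⇒∣∣≡0 J J-empty)
  where
  J-empty : Empty J
  J-empty (j , j∈J) = zero-column A j indJ j∈J (λ i →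
    let (Rj⊆L , colRj) = rep j j∈J
    in trans (sym (colRj i)) (cycle-empty W (λ (y , y∈) → ∣∣≡0⇒empty L ∣L∣≡0 (y , Rj⊆L y∈)) i))
exchange (suc k) A W J L R ∣L∣≡1+k indJ rep
  with ∣∣≡suc⇒nonempty L ∣L∣≡1+k
... | l , l∈L with any? (λ j → (j ∈? J) ×-dec (l ∈? R j))
... | no unused = ℕ.m≤n⇒m≤1+n (exchange k A W J (L ∖ ⁅ l ⁆) R ∣L∖l∣≡k indJ rep')
  where
  ∣L∖l∣≡k : ∣ L ∖ ⁅ l ⁆ ∣ ≡ k
  ∣L∖l∣≡k = ℕ.suc-injective (trans (sym (∣∣-remove l∈L)) ∣L∣≡1+k)
  rep' : Represents A W J (L ∖ ⁅ l ⁆) R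
  rep' j j∈J = (λ y∈ → ∈∖⁺ (proj₁ (rep j j∈J) y∈)
                          (λ y∈l → unused (j , j∈J , ∈⁅⁆-transfer (R j) y∈l y∈)))
             , proj₂ (rep j j∈J)
... | yes (j0 , j0∈J , l∈R0) = subst (_≤ suc k) (sym (∣∣-remove j0∈J)) (s≤s IH)
  where
  open Pivot A W R j0 l
  IH : ∣ J ∖ ⁅ j0 ⁆ ∣ ≤ k
  IH = exchange k A' W (J ∖ ⁅ j0 ⁆) (L ∖ ⁅ l ⁆) R'
         (ℕ.suc-injective (trans (sym (∣∣-remove l∈L)) ∣L∣≡1+k))
         (independent j0∈J indJ) (represents l∈R0 j0∈J rep)

independent≤spanning : ∀ {r n} (A : BinMatrix r n) {J L} → Independent A J →
  (∀ j → j ∈ J → InSpan A L (column A j)) → ∣ J ∣ ≤ ∣ L ∣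
independent≤spanning {n = n} A {J} {L} indJ span = exchange ∣ L ∣ A A J L R refl indJ rep
  where
  R : Fin n → Subset n
  R j with inSpan? A L j
  ... | yes (U , _) = U
  ... | no  _       = ⊥
  rep : Represents A A J L R
  rep j j∈J with inSpan? A L j
  ... | yes (_ , U⊆L , colU) = U⊆L , colU
  ... | no  j∉span           = ⊥-elim (j∉span (span j j∈J))

augment : ∀ {r n} (A : BinMatrix r n) {T k} → IsRank A T k → ∀ I → I ⊆ T → Independent A I →
  ∃[ K ] (I ⊆ K × K ⊆ T × Independent A K × ∣ K ∣ ≡ k)
augment A {T} {k} rank@((J , J⊆T , indJ , ∣J∣≡k) , bound) I₀ I₀⊆T indI₀ =
  grow (k ∸ ∣ I₀ ∣) I₀ I₀⊆T indI₀ (ℕ.m+[n∸m]≡n (bound I₀ I₀⊆T indI₀))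
  where
  grow : ∀ d I → I ⊆ T → Independent A I → ∣ I ∣ + d ≡ k →
    ∃[ K ] (I ⊆ K × K ⊆ T × Independent A K × ∣ K ∣ ≡ k)
  grow zero I I⊆T indI ∣I∣≡k = I , (λ j∈ → j∈) , I⊆T , indI , trans (sym (ℕ.+-identityʳ _)) ∣I∣≡k
  grow (suc d) I I⊆T indI ∣I∣+1+d≡k with any? (λ y → (y ∈? J) ×-dec ¬? (inSpan? A I y))
  ... | yes (y , y∈J , y∉span) =
    let y∉I = λ y∈I → y∉span (inSpan-self A y y∈I)
        (K , I∪y⊆K , rest) = grow d (I ∪ ⁅ y ⁆)
          (∪⁅⁆⊆ I⊆T (J⊆T y∈J))
          (independent-∪ A y indI y∉span)
          (trans (cong (_+ d) (∣∣-add I y∉I)) (trans (sym (ℕ.+-suc _ d)) ∣I∣+1+d≡k))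
    in K , (λ j∈ → I∪y⊆K (x∈p∪q⁺ (inj₁ j∈))) , rest
  ... | no J⊆span = ⊥-elim (ℕ.<-irrefl refl (ℕ.≤-<-trans k≤∣I∣ ∣I∣<k))
    where
    -- all of J lies in the span of I, so k = |J| ≤ |I| < |I| + 1 + d = k
    J-spanned : ∀ y → y ∈ J → InSpan A I (column A y)
    J-spanned y y∈J with inSpan? A I y
    ... | yes s  = s
    ... | no  ns = ⊥-elim (J⊆span (y , y∈J , ns))
    k≤∣I∣ : k ≤ ∣ I ∣
    k≤∣I∣ = subst (_≤ ∣ I ∣) ∣J∣≡k (independent≤spanning A indJ J-spanned)
    ∣I∣<k : ∣ I ∣ < k
    ∣I∣<k = subst (∣ I ∣ <_) ∣I∣+1+d≡k (ℕ.m<m+n ∣ I ∣ (s≤s z≤n))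

maximal-spans : ∀ {r n} (A : BinMatrix r n) {T k K} → IsRank A T k → K ⊆ T → Independent A K → ∣ K ∣ ≡ k →
  ∀ e → e ∈ T → InSpan A K (column A e)
maximal-spans A {T} {k} {K} (_ , bound) K⊆T indK ∣K∣≡k e e∈T with inSpan? A K e
... | yes s      = s
... | no e∉span  = ⊥-elim (ℕ.<-irrefl refl (subst (_≤ k) (trans (∣∣-add K e∉K) (cong suc ∣K∣≡k)) bigger))
  where
  e∉K : e ∉ K
  e∉K e∈K = e∉span (inSpan-self A e e∈K)
  bigger : ∣ K ∪ ⁅ e ⁆ ∣ ≤ k
  bigger = bound (K ∪ ⁅ e ⁆) (∪⁅⁆⊆ K⊆T e∈T) (independent-∪ A e indK e∉span)

-- Every set has a rank: search downwards from the trivial bound n.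
rank-exists : ∀ {r n} (A : BinMatrix r n) T → ∃[ k ] IsRank A T k
rank-exists {n = n} A T = search n (λ I _ _ → ∣p∣≤n I)
  where
  search : ∀ k → (∀ I → I ⊆ T → Independent A I → ∣ I ∣ ≤ k) → ∃[ k' ] IsRank A T k'
  search k bound with anySubset? (λ I → (I ⊆? T) ×-dec (independent? A I ×-dec (∣ I ∣ ℕ.≟ k)))
  ... | yes attained = k , attained , bound
  search zero    bound | no none =
    ⊥-elim (none (⊥ , ⊥⊆ , (λ U U⊆⊥ _ (j , j∈U) → ∉⊥ (U⊆⊥ j∈U)) , ∣⊥∣≡0 n))
  search (suc k) bound | no none = search k (λ I I⊆T indI →
    ℕ.≤-pred (ℕ.≤∧≢⇒< (bound I I⊆T indI) (λ ∣I∣≡1+k → none (I , I⊆T , indI , ∣I∣≡1+k))))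

circuit-minimal : ∀ {r n} {A : BinMatrix r n} {C} → Circuit A C →
  ∀ U → U ⊆ C → Cycle A U → Nonempty U → C ⊆ U
circuit-minimal {C = C} (_ , minimal) U U⊆C cU neU {c} c∈C with c ∈? U
... | yes c∈U = c∈U
... | no  c∉U = ⊥-elim (minimal U (U⊆C , c , c∈C , c∉U) U (λ j∈ → j∈) cU neU)

circuit-cycle : ∀ {r n} {A : BinMatrix r n} {C} → Circuit A C → Cycle A C × Nonempty C
circuit-cycle {A = A} circ with dependent⇒cycle (proj₁ circ)
... | U , U⊆C , cU , (u , u∈U) =
  subst (Cycle A) (⊆-antisym U⊆C (circuit-minimal circ U U⊆C cU (u , u∈U))) cU , u , U⊆C u∈U

minimal-cycle⇒circuit : ∀ {r n} {A : BinMatrix r n} {C} → Cycle A C → Nonempty C →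
  (∀ U → U ⊆ C → Cycle A U → Nonempty U → C ⊆ U) → Circuit A C
minimal-cycle⇒circuit {C = C} cC neC minimal =
  (λ indC → indC C (λ j∈ → j∈) cC neC) ,
  λ { D (D⊆C , w , w∈C , w∉D) U U⊆D cU neU →
        w∉D (U⊆D (minimal U (λ j∈ → D⊆C (U⊆D j∈)) cU neU w∈C)) }

⊂-wellFounded : ∀ {n} → WellFounded (_⊂_ {n})
⊂-wellFounded = Subrelation.wellFounded p⊂q⇒∣p∣<∣q∣ (On.wellFounded ∣_∣ <-wellFounded)

circuit-through : ∀ {r n} (A : BinMatrix r n) Z → Cycle A Z → ∀ e → e ∈ Z →
  ∃[ D ] (Circuit A D × D ⊆ Z × e ∈ D)
circuit-through A Z₀ cZ₀ e e∈Z₀ = go Z₀ (⊂-wellFounded Z₀) cZ₀ e∈Z₀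
  where
  go : ∀ Z → Acc _⊂_ Z → Cycle A Z → e ∈ Z → ∃[ D ] (Circuit A D × D ⊆ Z × e ∈ D)
  go Z (acc smaller) cZ e∈Z with anySubset? (λ V → (V ⊂? Z) ×-dec (cycle? A V ×-dec nonempty? V))
  ... | no noSubcycle = Z , minimal-cycle⇒circuit cZ (e , e∈Z) minimal , (λ j∈ → j∈) , e∈Z
    where
    minimal : ∀ U → U ⊆ Z → Cycle A U → Nonempty U → Z ⊆ U
    minimal U U⊆Z cU neU {c} c∈Z with c ∈? U
    ... | yes c∈U = c∈U
    ... | no  c∉U = ⊥-elim (noSubcycle (U , (U⊆Z , c , c∈Z , c∉U) , cU , neU))
  ... | yes (V , V⊂Z@(V⊆Z , _) , cV , (v , v∈V)) with e ∈? V
  ...   | yes e∈V = let (D , circD , D⊆V , e∈D) = go V (smaller V⊂Z) cV e∈V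
                    in D , circD , (λ j∈ → V⊆Z (D⊆V j∈)) , e∈D
  ...   | no  e∉V = let (D , circD , D⊆Z∖V , e∈D) = go (Z ∖ V) (smaller Z∖V⊂Z)
                                                      (cycle-∖ A Z V V⊆Z cZ cV) (∈∖⁺ e∈Z e∉V)
                    in D , circD , (λ j∈ → ∖⊆ Z V (D⊆Z∖V j∈)) , e∈D
    where
    Z∖V⊂Z : Z ∖ V ⊂ Z
    Z∖V⊂Z = ∖⊆ Z V , v , V⊆Z v∈V , (λ v∈Z∖V → proj₂ (∈∖⁻ Z V v∈Z∖V) v∈V)

CommonCircuit : ∀ {r n} → BinMatrix r n → Fin n → Fin n → Set
CommonCircuit A e g = ∃[ C ] (Circuit A C × e ∈ C × g ∈ C)

module CircuitSum {r n} (A : BinMatrix r n) {C C' : Subset n} {f}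
                  (circ : Circuit A C) (circ' : Circuit A C') (f∈C : f ∈ C) (f∈C' : f ∈ C') where

  -- D meets C', since otherwise D would be a proper subset of C (it misses f).
  meets : ∀ D → Circuit A D → D ⊆ C ⊕ C' → ∃[ h ] (h ∈ D × h ∈ C')
  meets D circD D⊆ with any? (λ h → (h ∈? D) ×-dec (h ∈? C'))
  ... | yes meet    = meet
  ... | no  disjoint = ⊥-elim (proj₁ circD (proj₂ circ D (D⊆C , f , f∈C , f∉D)))
    where
    D⊆C : D ⊆ C
    D⊆C {h} h∈D = ∈⊕-∉ʳ C C' (D⊆ h∈D) (λ h∈C' → disjoint (h , h∈D , h∈C'))
    f∉D : f ∉ D
    f∉D f∈D = ∉⊕-both C C' f∈C f∈C' (D⊆ f∈D)

  -- If D covers C ∖ C', then D ⊕ C is a non-empty cycle inside C', hence contains C'.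
  covering : ∀ D → Circuit A D → D ⊆ C ⊕ C' → C ∖ C' ⊆ D → C' ⊆ D ⊕ C
  covering D circD D⊆ covers =
    circuit-minimal circ' (D ⊕ C) sub (cycle-⊕ A D C (proj₁ (circuit-cycle circD)) (proj₁ (circuit-cycle circ)))
      (f , ∈⊕⁺ʳ (λ f∈D → ∉⊕-both C C' f∈C f∈C' (D⊆ f∈D)) f∈C)
    where
    sub : D ⊕ C ⊆ C'
    sub {x} x∈ with ∈⊕⁻ D C x∈ | x ∈? C'
    ... | _                 | yes x∈C' = x∈C'
    ... | inj₁ (x∈D , x∉C) | no x∉C'  = ⊥-elim (x∉C (∈⊕-∉ʳ C C' (D⊆ x∈D) x∉C'))
    ... | inj₂ (x∉D , x∈C) | no x∉C'  = ⊥-elim (x∉D (covers (∈∖⁺ x∈C x∉C')))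

-- Lying in a common circuit is transitive.  Induction on |C ∖ C₂|: a circuit D through e
-- inside C ⊕ C₂ either contains g, or shares an element with C₂ and has D ∖ C₂ ⊂ C ∖ C₂.
common-circuit-trans : ∀ {r n} (A : BinMatrix r n) {e f g} →
  CommonCircuit A e f → CommonCircuit A f g → CommonCircuit A e g
common-circuit-trans A {e} {f₀} {g} (C₁ , circ₁ , e∈C₁ , f∈C₁) (C₂ , circ₂ , f∈C₂ , g∈C₂) =
  go C₁ (On.wellFounded (_∖ C₂) ⊂-wellFounded C₁) circ₁ e∈C₁ f₀ f∈C₁ f∈C₂
  where
  go : ∀ C → Acc (_⊂_ on (_∖ C₂)) C → Circuit A C → e ∈ C →
       ∀ f → f ∈ C → f ∈ C₂ → CommonCircuit A e g
  go C (acc smaller) circ e∈C f f∈C f∈C₂ with g ∈? C | e ∈? C₂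
  ... | yes g∈C | _        = C , circ , e∈C , g∈C
  ... | no  _   | yes e∈C₂ = C₂ , circ₂ , e∈C₂ , g∈C₂
  ... | no  g∉C | no  e∉C₂
    with circuit-through A (C ⊕ C₂)
           (cycle-⊕ A C C₂ (proj₁ (circuit-cycle circ)) (proj₁ (circuit-cycle circ₂))) e (∈⊕⁺ˡ e∈C e∉C₂)
  ... | D , circD , D⊆ , e∈D with g ∈? D
  ...   | yes g∈D = D , circD , e∈D , g∈D
  ...   | no  g∉D with any? (λ c → (c ∈? C ∖ C₂) ×-dec ¬? (c ∈? D))
  ...     | yes (c , c∈C∖C₂ , c∉D) =
              let (h , h∈D , h∈C₂) = meets D circD D⊆
              in go D (smaller D∖C₂⊂C∖C₂) circD e∈D h h∈D h∈C₂
    where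
    open CircuitSum A circ circ₂ f∈C f∈C₂
    D∖C₂⊂C∖C₂ : D ∖ C₂ ⊂ C ∖ C₂
    D∖C₂⊂C∖C₂ = (λ x∈ → let (x∈D , x∉C₂) = ∈∖⁻ D C₂ x∈
                         in ∈∖⁺ (∈⊕-∉ʳ C C₂ (D⊆ x∈D) x∉C₂) x∉C₂)
              , c , c∈C∖C₂ , (λ c∈D∖C₂ → c∉D (∖⊆ D C₂ c∈D∖C₂))
  ...     | no  covered = ⊥-elim (g∉D (∈⊕-∉ʳ D C (covering D circD D⊆ C∖C₂⊆D g∈C₂) g∉C))
    where
    open CircuitSum A circ circ₂ f∈C f∈C₂
    C∖C₂⊆D : C ∖ C₂ ⊆ D
    C∖C₂⊆D {c} c∈ with c ∈? D
    ... | yes c∈D = c∈D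
    ... | no  c∉D = ⊥-elim (covered (c , c∈ , c∉D))

circuit? : ∀ {r n} (A : BinMatrix r n) C → Dec (Circuit A C)
circuit? A C = ¬? (independent? A C) ×-dec minimal?
  where
  minimal? : Dec (∀ D → D ⊂ C → Independent A D)
  minimal? with anySubset? (λ D → (D ⊂? C) ×-dec ¬? (independent? A D))
  ... | yes (D , D⊂C , depD) = no (λ minimal → depD (minimal D D⊂C))
  ... | no  noDependent      = yes minimal
    where
    minimal : ∀ D → D ⊂ C → Independent A D
    minimal D D⊂C with independent? A D
    ... | yes indD = indD
    ... | no  depD = ⊥-elim (noDependent (D , D⊂C , depD))

sameComponent? : ∀ {r n} (A : BinMatrix r n) e f → Dec (SameComponent A e f)
sameComponent? A e f = (e ≟ f) ⊎-dec anySubset? (λ C → circuit? A C ×-dec ((e ∈? C) ×-dec (f ∈? C)))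

component : ∀ {r n} → BinMatrix r n → Fin n → Subset n
component A e = tabulate (λ f → ⌊ sameComponent? A e f ⌋)

∈component⁻ : ∀ {r n} (A : BinMatrix r n) {e f} → f ∈ component A e → SameComponent A e f
∈component⁻ A {e} {f} f∈ with sameComponent? A e f | trans (sym (lookup∘tabulate _ f)) (∈⇒! f∈)
... | yes same | _ = same

∈component⁺ : ∀ {r n} (A : BinMatrix r n) {e f} → SameComponent A e f → f ∈ component A e
∈component⁺ A {e} {f} same =
  !⇒∈ (trans (lookup∘tabulate _ f) (⌊⌋-true (sameComponent? A e f) same))

CircuitClosed : ∀ {r n} → BinMatrix r n → Subset n → Set
CircuitClosed A K = ∀ C → Circuit A C → ∀ a b → a ∈ C → b ∈ C → a ∈ K → b ∈ K

∩-split : ∀ {n} {Z D : Subset n} (K : Subset n) → D ⊆ Z → Z ∩ K ≡ ((Z ∖ D) ∩ K) ⊕ (D ∩ K)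
∩-split {Z = Z} {D} K D⊆Z = subset-ext bitwise
  where
  bitwise : ∀ j → (Z ∩ K) ! j ≡ (((Z ∖ D) ∩ K) ⊕ (D ∩ K)) ! j
  bitwise j rewrite !-⊕ ((Z ∖ D) ∩ K) (D ∩ K) j | !-∩ (Z ∖ D) K j | !-∩ D K j | !-∖ Z D j | !-∩ Z K j
    with D ! j in ed
  ... | true  rewrite ∈⇒! (D⊆Z (!⇒∈ ed)) = refl
  ... | false rewrite ∧-identityʳ (Z ! j) = sym (xor-identityʳ _)

-- Cycles restrict to circuit-closed sets: peel circuits off the cycle one at a time.
cycle-∩-closed : ∀ {r n} (A : BinMatrix r n) {K} → CircuitClosed A K → ∀ Z → Cycle A Z → Cycle A (Z ∩ K)
cycle-∩-closed A {K} closed Z₀ cZ₀ = go Z₀ (⊂-wellFounded Z₀) cZ₀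
  where
  go : ∀ Z → Acc _⊂_ Z → Cycle A Z → Cycle A (Z ∩ K)
  go Z (acc smaller) cZ with nonempty? Z
  ... | no  em = cycle-empty A (λ (j , j∈) → em (j , proj₁ (x∈p∩q⁻ Z K j∈)))
  ... | yes (z , z∈Z) with circuit-through A Z cZ z z∈Z
  ... | D , circD , D⊆Z , z∈D =
    subst (Cycle A) (sym (∩-split K D⊆Z))
      (cycle-⊕ A ((Z ∖ D) ∩ K) (D ∩ K) (go (Z ∖ D) (smaller Z∖D⊂Z) (cycle-∖ A Z D D⊆Z cZ cD)) D∩K-cycle)
    where
    cD : Cycle A D
    cD = proj₁ (circuit-cycle circD)
    Z∖D⊂Z : Z ∖ D ⊂ Z
    Z∖D⊂Z = ∖⊆ Z D , z , z∈Z , (λ z∈Z∖D → proj₂ (∈∖⁻ Z D z∈Z∖D) z∈D)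
    -- D lies entirely inside or entirely outside K
    D∩K-cycle : Cycle A (D ∩ K)
    D∩K-cycle with z ∈? K
    ... | yes z∈K = subst (Cycle A) (⊆-antisym (λ j∈D → x∈p∩q⁺ (j∈D , closed D circD z _ z∈D j∈D z∈K))
                                                (λ j∈ → proj₁ (x∈p∩q⁻ D K j∈))) cD
    ... | no  z∉K = cycle-empty A (λ (j , j∈) → let (j∈D , j∈K) = x∈p∩q⁻ D K j∈
                                                  in z∉K (closed D circD j z j∈D z∈D j∈K))

-- Components are closed under circuits, by transitivity of lying in a common circuit.
component-closed : ∀ {r n} (A : BinMatrix r n) e → CircuitClosed A (component A e)
component-closed A e C circ a b a∈C b∈C a∈K with ∈component⁻ A a∈K
... | inj₁ refl  = ∈component⁺ A (inj₂ (C , circ , a∈C , b∈C))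
... | inj₂ common = ∈component⁺ A (inj₂ (common-circuit-trans A common (C , circ , a∈C , b∈C)))

∣∣-disjoint-∪ : ∀ {n} (P K₁ K₂ : Subset n) → K₁ ⊆ P → K₂ ⊆ ∁ P →
  ∣ K₁ ∪ K₂ ∣ ≡ ∣ K₁ ∣ + ∣ K₂ ∣
∣∣-disjoint-∪ P K₁ K₂ K₁⊆P K₂⊆∁P =
  trans (∣∣-split (K₁ ∪ K₂) P) (cong₂ _+_ (cong ∣_∣ inside) (cong ∣_∣ outside))
  where
  inside : (K₁ ∪ K₂) ∩ P ≡ K₁
  inside = ⊆-antisym
    (λ j∈ → let (j∈K , j∈P) = x∈p∩q⁻ (K₁ ∪ K₂) P j∈ in
            [ (λ j∈K₁ → j∈K₁) , (λ j∈K₂ → ⊥-elim (x∈∁p⇒x∉p (K₂⊆∁P j∈K₂) j∈P)) ]′ (x∈p∪q⁻ K₁ K₂ j∈K))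
    (λ j∈K₁ → x∈p∩q⁺ (x∈p∪q⁺ (inj₁ j∈K₁) , K₁⊆P j∈K₁))
  outside : (K₁ ∪ K₂) ∖ P ≡ K₂
  outside = ⊆-antisym
    (λ j∈ → let (j∈K , j∉P) = ∈∖⁻ (K₁ ∪ K₂) P j∈ in
            [ (λ j∈K₁ → ⊥-elim (j∉P (K₁⊆P j∈K₁))) , (λ j∈K₂ → j∈K₂) ]′ (x∈p∪q⁻ K₁ K₂ j∈K))
    (λ j∈K₂ → ∈∖⁺ (x∈p∪q⁺ (inj₂ j∈K₂)) (x∈∁p⇒x∉p (K₂⊆∁P j∈K₂)))

-- If Q spans every column and contains a cycle C ∋ f, then Q ∖ {f} still spans every column:
-- a representation using f is corrected by adding C.
spanning-remove : ∀ {r n} (A : BinMatrix r n) {Q C f} → (∀ e → InSpan A Q (column A e)) →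
  Cycle A C → C ⊆ Q → f ∈ C → ∀ e → InSpan A (Q ∖ ⁅ f ⁆) (column A e)
spanning-remove A {Q} {C} {f} span cC C⊆Q f∈C e with span e
... | U , U⊆Q , colU with f ∈? U
...   | no  f∉U = U , (λ j∈U → ∈∖⁺ (U⊆Q j∈U) (λ j∈f → f∉U (∈⁅⁆-transfer U j∈f j∈U))) , colU
...   | yes f∈U = U ⊕ C , sub , λ i →
  trans (colSum-⊕ A U C i) (trans (cong₂ _xor_ (colU i) (cC i)) (xor-identityʳ _))
  where
  sub : U ⊕ C ⊆ Q ∖ ⁅ f ⁆
  sub j∈ = ∈∖⁺ ([ (λ (j∈U , _) → U⊆Q j∈U) , (λ (_ , j∈C) → C⊆Q j∈C) ]′ (∈⊕⁻ U C j∈))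
               (λ j∈f → ∉⊕-both U C f∈U f∈C (∈⁅⁆-transfer (U ⊕ C) j∈f j∈))

inSpan-⊆ : ∀ {r n} {A : BinMatrix r n} {L L' v} → L ⊆ L' → InSpan A L v → InSpan A L' v
inSpan-⊆ L⊆L' (U , U⊆L , colU) = U , (λ j∈ → L⊆L' (U⊆L j∈)) , colU

circuit-halves : ∀ {r n} {A : BinMatrix r n} {C} (P : Subset n) {e f} → Circuit A C →
  e ∈ C → f ∈ C → e ∈ P → f ∉ P → Independent A (C ∩ P) × Independent A (C ∖ P)
circuit-halves {C = C} P {e} {f} circ e∈C f∈C e∈P f∉P =
  proj₂ circ (C ∩ P) (p∩q⊆p C P , f , f∈C , λ f∈ → f∉P (proj₂ (x∈p∩q⁻ C P f∈))) ,
  proj₂ circ (C ∖ P) (∖⊆ C P , e , e∈C , λ e∈ → proj₂ (∈∖⁻ C P e∈) e∈P)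

-- Otherwise extend its halves to bases
-- K₁ of P and K₂ of ∁ P; then K₁ ∪ K₂ has r(M) = r(P) + r(∁ P) elements and spans M,
-- yet still spans M after removing an element of the circuit, contradicting Steinitz.
circuit-one-side : ∀ {r n} (A : BinMatrix r n) {P C e f} → OneSeparation A P → Circuit A C →
  e ∈ C → f ∈ C → e ∈ P → f ∉ P → False
circuit-one-side A {P} {C} {e} {f} (_ , _ , ka , kb , k , rankP , rank∁P , ((J , _ , indJ , ∣J∣≡k) , _) , ka+kb≡k)
                 circ e∈C f∈C e∈P f∉P
  with circuit-halves P circ e∈C f∈C e∈P f∉P
... | ind₁ , ind₂
  with augment A rankP (C ∩ P) (p∩q⊆q C P) ind₁ | augment A rank∁P (C ∖ P) (p∩q⊆q C (∁ P)) ind₂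
... | K₁ , C∩P⊆K₁ , K₁⊆P , indK₁ , ∣K₁∣≡ka | K₂ , C∖P⊆K₂ , K₂⊆∁P , indK₂ , ∣K₂∣≡kb =
  ℕ.<-irrefl refl (ℕ.≤-<-trans k≤∣Q∖f∣ ∣Q∖f∣<k)
  where
  Q : Subset _
  Q = K₁ ∪ K₂
  C⊆Q : C ⊆ Q
  C⊆Q {j} j∈C with j ∈? P
  ... | yes j∈P = x∈p∪q⁺ (inj₁ (C∩P⊆K₁ (x∈p∩q⁺ (j∈C , j∈P))))
  ... | no  j∉P = x∈p∪q⁺ (inj₂ (C∖P⊆K₂ (∈∖⁺ j∈C j∉P)))
  Q-spans : ∀ j → InSpan A Q (column A j)
  Q-spans j with j ∈? P
  ... | yes j∈P = inSpan-⊆ (λ x∈ → x∈p∪q⁺ (inj₁ x∈))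
                    (maximal-spans A rankP K₁⊆P indK₁ ∣K₁∣≡ka j j∈P)
  ... | no  j∉P = inSpan-⊆ (λ x∈ → x∈p∪q⁺ (inj₂ x∈))
                    (maximal-spans A rank∁P K₂⊆∁P indK₂ ∣K₂∣≡kb j (x∉p⇒x∈∁p j∉P))
  k≤∣Q∖f∣ : k ≤ ∣ Q ∖ ⁅ f ⁆ ∣
  k≤∣Q∖f∣ = subst (_≤ ∣ Q ∖ ⁅ f ⁆ ∣) ∣J∣≡k (independent≤spanning A indJ (λ j _ →
    spanning-remove A Q-spans (proj₁ (circuit-cycle circ)) C⊆Q f∈C j))
  ∣Q∖f∣<k : ∣ Q ∖ ⁅ f ⁆ ∣ < k
  ∣Q∖f∣<k = ℕ.≤-reflexive (begin
    suc ∣ Q ∖ ⁅ f ⁆ ∣   ≡⟨ sym (∣∣-remove (C⊆Q f∈C)) ⟩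
    ∣ Q ∣               ≡⟨ ∣∣-disjoint-∪ P K₁ K₂ K₁⊆P K₂⊆∁P ⟩
    ∣ K₁ ∣ + ∣ K₂ ∣     ≡⟨ cong₂ _+_ ∣K₁∣≡ka ∣K₂∣≡kb ⟩
    ka + kb             ≡⟨ ka+kb≡k ⟩
    k                   ∎)
    where open ≡-Reasoning

same-side : ∀ {r n} (A : BinMatrix r n) {P C} → OneSeparation A P → Circuit A C →
  ∀ a b → a ∈ C → b ∈ C → P ! a ≡ P ! b
same-side A {P} sep circ a b a∈C b∈C with P ! a in pa | P ! b in pb
... | true  | true  = refl
... | false | false = refl
... | true  | false = ⊥-elim (circuit-one-side A sep circ a∈C b∈C (!⇒∈ pa) (!⇒∉ pb))
... | false | true  = ⊥-elim (circuit-one-side A sep circ b∈C a∈C (!⇒∈ pb) (!⇒∉ pa))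

separation-two-sided : ∀ {r n} {A : BinMatrix r n} {P} → OneSeparation A P →
  ∀ j₀ → ¬ (∀ j → P ! j ≡ P ! j₀)
separation-two-sided {P = P} ((a , a∈P) , (b , b∈∁P) , _) j₀ one-sided =
  true≢false (trans (sym (trans (sym (one-sided a)) (∈⇒! a∈P)))
                    (trans (sym (one-sided b)) (∉⇒! (x∈∁p⇒x∉p b∈∁P))))

same-component-side : ∀ {r n} (A : BinMatrix r n) {P e f} → OneSeparation A P → SameComponent A e f → P ! e ≡ P ! f
same-component-side A sep (inj₁ refl)                 = refl
same-component-side A sep (inj₂ (C , circ , e∈C , f∈C)) = same-side A sep circ _ _ e∈C f∈C

common-component⇒connected : ∀ {r n} (A : BinMatrix r n) a → (∀ e → SameComponent A e a) → Connected A
common-component⇒connected A a same (P , sep) = separation-two-sided sep a (λ e → same-component-side A sep (same e))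

-- A proper non-empty P such that every cycle restricts to a cycle on P is a 1-separation:
-- independent sets of the two sides combine, and an independent set splits.
splitting⇒separation : ∀ {r n} (A : BinMatrix r n) P → Nonempty P → Nonempty (∁ P) →
  (∀ Z → Cycle A Z → Cycle A (Z ∩ P)) → OneSeparation A P
splitting⇒separation A P neP ne∁P splits with rank-exists A P | rank-exists A (∁ P) | rank-exists A ⊤
... | ka , rankP@((I₁ , I₁⊆P , indI₁ , ∣I₁∣≡ka) , boundP)
    | kb , rank∁P@((I₂ , I₂⊆∁P , indI₂ , ∣I₂∣≡kb) , bound∁P)
    | k  , rank⊤@((J , _ , indJ , ∣J∣≡k) , bound⊤) =
  neP , ne∁P , ka , kb , k , rankP , rank∁P , rank⊤ , ℕ.≤-antisym ka+kb≤k k≤ka+kb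
  where
  I₁∪I₂-independent : Independent A (I₁ ∪ I₂)
  I₁∪I₂-independent V V⊆ cV (v , v∈V) with v ∈? P
  ... | yes v∈P = indI₁ (V ∩ P) V∩P⊆I₁ (splits V cV) (v , x∈p∩q⁺ (v∈V , v∈P))
    where
    V∩P⊆I₁ : V ∩ P ⊆ I₁
    V∩P⊆I₁ j∈ = let (j∈V , j∈P) = x∈p∩q⁻ V P j∈ in
      [ (λ j∈I₁ → j∈I₁) , (λ j∈I₂ → ⊥-elim (x∈∁p⇒x∉p (I₂⊆∁P j∈I₂) j∈P)) ]′
        (x∈p∪q⁻ I₁ I₂ (V⊆ j∈V))
  ... | no  v∉P = indI₂ (V ∖ (V ∩ P)) rest⊆I₂ (cycle-∖ A V (V ∩ P) (p∩q⊆p V P) cV (splits V cV))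
                    (v , ∈∖⁺ v∈V (λ v∈ → v∉P (proj₂ (x∈p∩q⁻ V P v∈))))
    where
    rest⊆I₂ : V ∖ (V ∩ P) ⊆ I₂
    rest⊆I₂ j∈ = let (j∈V , j∉V∩P) = ∈∖⁻ V (V ∩ P) j∈ in
      [ (λ j∈I₁ → ⊥-elim (j∉V∩P (x∈p∩q⁺ (j∈V , I₁⊆P j∈I₁)))) , (λ j∈I₂ → j∈I₂) ]′
        (x∈p∪q⁻ I₁ I₂ (V⊆ j∈V))
  ka+kb≤k : ka + kb ≤ k
  ka+kb≤k = subst (_≤ k) (trans (∣∣-disjoint-∪ P I₁ I₂ I₁⊆P I₂⊆∁P) (cong₂ _+_ ∣I₁∣≡ka ∣I₂∣≡kb))
                  (bound⊤ (I₁ ∪ I₂) (λ _ → ∈⊤) I₁∪I₂-independent)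
  k≤ka+kb : k ≤ ka + kb
  k≤ka+kb = subst (_≤ ka + kb) (trans (sym (∣∣-split J P)) ∣J∣≡k)
    (ℕ.+-mono-≤ (boundP (J ∩ P) (p∩q⊆q J P) (independent-⊆ (p∩q⊆p J P) indJ))
                (bound∁P (J ∖ P) (p∩q⊆q J (∁ P)) (independent-⊆ (∖⊆ J P) indJ)))

anyB-true : ∀ {m} (f : Fin m → Bool) g → f g ≡ true → anyB f ≡ true
anyB-true f zero    fg≡true = cong (_∨ anyB (λ j → f (suc j))) fg≡true
anyB-true f (suc g) fg≡true = trans (cong (f zero ∨_) (anyB-true (λ j → f (suc j)) g fg≡true)) (∨-zeroʳ (f zero))

x∈imageSet : ∀ {m n} (x : Fin m → Fin n) g → x g ∈ imageSet x
x∈imageSet x g = !⇒∈ (trans (lookup∘tabulate _ (x g)) (anyB-true (λ h → ⌊ x h ≟ x g ⌋) g (⌊⌋-true (x g ≟ x g) refl)))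

module Extension {r n m} (A : BinMatrix r n) (x : Fin m → Fin n) where

  B : BinMatrix (suc r) (n + m)
  B = gammaExt A x

  ι : Fin n → Fin (n + m)
  ι s = s ↑ˡ m

  γ : Fin m → Fin (n + m)
  γ g = n ↑ʳ g

  B-ι₀ : ∀ s → B zero (ι s) ≡ false
  B-ι₀ s rewrite splitAt-↑ˡ n s m = refl

  B-γ₀ : ∀ g → B zero (γ g) ≡ true
  B-γ₀ g rewrite splitAt-↑ʳ n m g = refl

  B-ι : ∀ i s → B (suc i) (ι s) ≡ A i s
  B-ι i s rewrite splitAt-↑ˡ n s m = refl

  B-γ : ∀ i g → B (suc i) (γ g) ≡ A i (x g)
  B-γ i g rewrite splitAt-↑ʳ n m g = refl

  ι≢γ : ∀ s g → ¬ ι s ≡ γ g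
  ι≢γ s g e with trans (sym (splitAt-↑ˡ n s m)) (trans (cong (splitAt n) e) (splitAt-↑ʳ n m g))
  ... | ()

  element-cases : ∀ j → (∃[ s ] ι s ≡ j) ⊎ (∃[ g ] γ g ≡ j)
  element-cases j with splitAt n {m} j in eq
  ... | inj₁ s = inj₁ (s , splitAt⁻¹-↑ˡ eq)
  ... | inj₂ g = inj₂ (g , splitAt⁻¹-↑ʳ eq)

  restrict : Subset (n + m) → Subset n
  restrict U = tabulate (λ s → U ! ι s)

  !-restrict : ∀ U s → restrict U ! s ≡ U ! ι s
  !-restrict U s = lookup∘tabulate _ s

  colSum-row₀ : ∀ U → colSum B U zero ≡ xorSum (λ g → U ! γ g)
  colSum-row₀ U = trans (xorSum-+ n (λ j → U ! j ∧ B zero j)) (cong₂ _xor_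
    (xorSum-zero _ (λ s → trans (cong (U ! ι s ∧_) (B-ι₀ s)) (∧-zeroʳ _)))
    (xorSum-cong (λ g → trans (cong (U ! γ g ∧_) (B-γ₀ g)) (∧-identityʳ _))))

  colSum-row : ∀ U i → colSum B U (suc i) ≡ colSum A (restrict U) i xor xorSum (λ g → U ! γ g ∧ A i (x g))
  colSum-row U i = trans (xorSum-+ n (λ j → U ! j ∧ B (suc i) j)) (cong₂ _xor_
    (xorSum-cong (λ s → cong₂ _∧_ (sym (!-restrict U s)) (B-ι i s)))
    (xorSum-cong (λ g → cong (U ! γ g ∧_) (B-γ i g))))

  embed : Subset n → Subset (n + m)
  embed K = tabulate (λ j → [ (K !_) , (λ _ → false) ]′ (splitAt n j))

  embed-ι : ∀ K s → embed K ! ι s ≡ K ! s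
  embed-ι K s = trans (lookup∘tabulate _ (ι s)) (cong [ (K !_) , (λ _ → false) ]′ (splitAt-↑ˡ n s m))

  embed-γ : ∀ K g → embed K ! γ g ≡ false
  embed-γ K g = trans (lookup∘tabulate _ (γ g)) (cong [ (K !_) , (λ _ → false) ]′ (splitAt-↑ʳ n m g))

  restrict-embed : ∀ K → restrict (embed K) ≡ K
  restrict-embed K = subset-ext (λ s → trans (!-restrict (embed K) s) (embed-ι K s))

  image-sum : (Fin m → Bool) → Subset n
  image-sum c = tabulate (λ s → xorSum (λ g → c g ∧ ⌊ x g ≟ s ⌋))

  colSum-image-sum : ∀ c i → colSum A (image-sum c) i ≡ xorSum (λ g → c g ∧ A i (x g))
  colSum-image-sum c i = begin
    xorSum (λ s → image-sum c ! s ∧ A i s)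
      ≡⟨ xorSum-cong (λ s → trans (cong (_∧ A i s) (lookup∘tabulate _ s))
                                  (sym (xorSum-∧ʳ (λ g → c g ∧ ⌊ x g ≟ s ⌋) (A i s)))) ⟩
    xorSum (λ s → xorSum (λ g → (c g ∧ ⌊ x g ≟ s ⌋) ∧ A i s))
      ≡⟨ xorSum-swap (λ s g → (c g ∧ ⌊ x g ≟ s ⌋) ∧ A i s) ⟩
    xorSum (λ g → xorSum (λ s → (c g ∧ ⌊ x g ≟ s ⌋) ∧ A i s))
      ≡⟨ xorSum-cong (λ g → trans (xorSum-cong {n} (λ s → ∧-assoc (c g) ⌊ x g ≟ s ⌋ (A i s)))
                                  (xorSum-∧ˡ (c g) (λ s → ⌊ x g ≟ s ⌋ ∧ A i s))) ⟩
    xorSum (λ g → c g ∧ xorSum (λ s → ⌊ x g ≟ s ⌋ ∧ A i s))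
      ≡⟨ xorSum-cong (λ g → cong (c g ∧_) (trans (xorSum-single _ (x g) off) on)) ⟩
    xorSum (λ g → c g ∧ A i (x g)) ∎
    where
    open ≡-Reasoning
    off : ∀ {g} s → ¬ s ≡ x g → ⌊ x g ≟ s ⌋ ∧ A i s ≡ false
    off {g} s s≢xg with x g ≟ s
    ... | yes e = ⊥-elim (s≢xg (sym e))
    ... | no  _ = refl
    on : ∀ {g} → ⌊ x g ≟ x g ⌋ ∧ A i (x g) ≡ A i (x g)
    on {g} with x g ≟ x g
    ... | yes _  = refl
    ... | no  ne = ⊥-elim (ne refl)

  image-sum-support : ∀ c s → image-sum c ! s ≡ true → ∃[ g ] x g ≡ s
  image-sum-support c s bit with xorSum-true _ (trans (sym (lookup∘tabulate _ s)) bit)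
  ... | g , term with x g ≟ s
  ...   | yes xg≡s = g , xg≡s
  ...   | no  _    = ⊥-elim (true≢false (trans (sym term) (∧-zeroʳ (c g))))

  project-cycle : ∀ Z → Cycle B Z → Cycle A (restrict Z ⊕ image-sum (λ g → Z ! γ g))
  project-cycle Z cZ i = begin
    colSum A (restrict Z ⊕ image-sum (λ g → Z ! γ g)) i
      ≡⟨ colSum-⊕ A (restrict Z) _ i ⟩
    colSum A (restrict Z) i xor colSum A (image-sum (λ g → Z ! γ g)) i
      ≡⟨ cong (colSum A (restrict Z) i xor_) (colSum-image-sum _ i) ⟩
    colSum A (restrict Z) i xor xorSum (λ g → Z ! γ g ∧ A i (x g))
      ≡⟨ sym (colSum-row Z i) ⟩
    colSum B Z (suc i)
      ≡⟨ cZ (suc i) ⟩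
    false ∎
    where open ≡-Reasoning

  ι∈embed : ∀ {K s} → s ∈ K → ι s ∈ embed K
  ι∈embed {K} {s} s∈K = !⇒∈ (trans (embed-ι K s) (∈⇒! s∈K))

  γ∉embed : ∀ K g → γ g ∉ embed K
  γ∉embed K g = !⇒∉ (embed-γ K g)

  ∈embed⁻ : ∀ K {j} → j ∈ embed K → ∃[ s ] (ι s ≡ j × s ∈ K)
  ∈embed⁻ K {j} j∈ with element-cases j
  ... | inj₁ (s , refl) = s , refl , !⇒∈ (trans (sym (embed-ι K s)) (∈⇒! j∈))
  ... | inj₂ (g , refl) = ⊥-elim (γ∉embed K g j∈)

  ∈restrict⁺ : ∀ {U s} → ι s ∈ U → s ∈ restrict U
  ∈restrict⁺ {U} {s} ιs∈U = !⇒∈ (trans (!-restrict U s) (∈⇒! ιs∈U))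

  ∈restrict⁻ : ∀ {U s} → s ∈ restrict U → ι s ∈ U
  ∈restrict⁻ {U} {s} s∈ = !⇒∈ (trans (sym (!-restrict U s)) (∈⇒! s∈))

  cycle-without-Γ : ∀ U → (∀ g → γ g ∉ U) → Cycle B U → Cycle A (restrict U)
  cycle-without-Γ U noΓ cU i = trans (sym (xor-identityʳ _)) (trans
    (cong (colSum A (restrict U) i xor_) (sym (xorSum-zero _ (λ g → cong (_∧ A i (x g)) (∉⇒! (noΓ g))))))
    (trans (sym (colSum-row U i)) (cU (suc i))))

  cycle-without-Γ⁺ : ∀ U → (∀ g → γ g ∉ U) → Cycle A (restrict U) → Cycle B U
  cycle-without-Γ⁺ U noΓ cU zero    = trans (colSum-row₀ U) (xorSum-zero _ (λ g → ∉⇒! (noΓ g)))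
  cycle-without-Γ⁺ U noΓ cU (suc i) = trans (colSum-row U i)
    (cong₂ _xor_ (cU i) (xorSum-zero _ (λ g → cong (_∧ A i (x g)) (∉⇒! (noΓ g)))))

  lift-circuit : ∀ {C} → Circuit A C → Circuit B (embed C)
  lift-circuit {C} circ with circuit-cycle circ
  ... | cC , (c , c∈C) = minimal-cycle⇒circuit cycle (ι c , ι∈embed c∈C) minimal
    where
    cycle : Cycle B (embed C)
    cycle = cycle-without-Γ⁺ (embed C) (γ∉embed C) (subst (Cycle A) (sym (restrict-embed C)) cC)
    minimal : ∀ U → U ⊆ embed C → Cycle B U → Nonempty U → embed C ⊆ U
    minimal U U⊆ cU (u , u∈U) j∈ =
      let (s , ιs≡j , s∈C) = ∈embed⁻ C j∈
      in subst (_∈ U) ιs≡j (∈restrict⁻ (circuit-minimal circ (restrict U) restrict⊆C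
                                          (cycle-without-Γ U noΓ cU) (s₀ , ∈restrict⁺ ιs₀∈U) s∈C))
      where
      noΓ : ∀ g → γ g ∉ U
      noΓ g γg∈U = γ∉embed C g (U⊆ γg∈U)
      restrict⊆C : restrict U ⊆ C
      restrict⊆C {s} s∈ = let (s' , ιs'≡ιs , s'∈C) = ∈embed⁻ C (U⊆ (∈restrict⁻ s∈))
                          in subst (_∈ C) (↑ˡ-injective m s' s ιs'≡ιs) s'∈C
      s₀ : Fin n
      s₀ = proj₁ (∈embed⁻ C (U⊆ u∈U))
      ιs₀∈U : ι s₀ ∈ U
      ιs₀∈U = subst (_∈ U) (sym (proj₁ (proj₂ (∈embed⁻ C (U⊆ u∈U))))) u∈U

  module Quad (injective : Injective _≡_ _≡_ x) (indX : Independent A (imageSet x))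
              {g g' : Fin m} (g≢g' : ¬ g ≡ g') where

    Q : Subset (n + m)
    Q = ⁅ ι (x g) ⁆ ∪ ⁅ ι (x g') ⁆ ∪ ⁅ γ g ⁆ ∪ ⁅ γ g' ⁆

    ∈Q⁻ : ∀ {j} → j ∈ Q → j ≡ ι (x g) ⊎ j ≡ ι (x g') ⊎ j ≡ γ g ⊎ j ≡ γ g'
    ∈Q⁻ j∈ with x∈p∪q⁻ ⁅ ι (x g) ⁆ _ j∈
    ... | inj₁ h = inj₁ (x∈⁅y⁆⇒x≡y _ h)
    ... | inj₂ j∈₁ with x∈p∪q⁻ ⁅ ι (x g') ⁆ _ j∈₁
    ...   | inj₁ h = inj₂ (inj₁ (x∈⁅y⁆⇒x≡y _ h))
    ...   | inj₂ j∈₂ with x∈p∪q⁻ ⁅ γ g ⁆ _ j∈₂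
    ...     | inj₁ h = inj₂ (inj₂ (inj₁ (x∈⁅y⁆⇒x≡y _ h)))
    ...     | inj₂ h = inj₂ (inj₂ (inj₂ (x∈⁅y⁆⇒x≡y _ h)))

    ιxg∈Q : ι (x g) ∈ Q
    ιxg∈Q = x∈p∪q⁺ (inj₁ (x∈⁅x⁆ _))
    ιxg'∈Q : ι (x g') ∈ Q
    ιxg'∈Q = x∈p∪q⁺ (inj₂ (x∈p∪q⁺ (inj₁ (x∈⁅x⁆ _))))
    γg∈Q : γ g ∈ Q
    γg∈Q = x∈p∪q⁺ (inj₂ (x∈p∪q⁺ (inj₂ (x∈p∪q⁺ (inj₁ (x∈⁅x⁆ _))))))
    γg'∈Q : γ g' ∈ Q
    γg'∈Q = x∈p∪q⁺ (inj₂ (x∈p∪q⁺ (inj₂ (x∈p∪q⁺ (inj₂ (x∈⁅x⁆ _))))))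

    xg≢xg' : ¬ x g ≡ x g'
    xg≢xg' e = g≢g' (injective e)

    module Bits (U : Subset (n + m)) (U⊆Q : U ⊆ Q) where
      a b c d : Bool
      a = U ! γ g
      b = U ! γ g'
      c = U ! ι (x g)
      d = U ! ι (x g')

      ι-off : ∀ s → ¬ s ≡ x g → ¬ s ≡ x g' → restrict U ! s ≡ false
      ι-off s s≢xg s≢xg' = trans (!-restrict U s) (∉⇒! (λ ιs∈U → case (∈Q⁻ (U⊆Q ιs∈U))))
        where
        case : _ → False
        case (inj₁ e)               = s≢xg (↑ˡ-injective m s (x g) e)
        case (inj₂ (inj₁ e))        = s≢xg' (↑ˡ-injective m s (x g') e)
        case (inj₂ (inj₂ (inj₁ e))) = ι≢γ s g e
        case (inj₂ (inj₂ (inj₂ e))) = ι≢γ s g' e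

      γ-off : ∀ h → ¬ h ≡ g → ¬ h ≡ g' → U ! γ h ≡ false
      γ-off h h≢g h≢g' = ∉⇒! (λ γh∈U → case (∈Q⁻ (U⊆Q γh∈U)))
        where
        case : _ → False
        case (inj₁ e)               = ι≢γ (x g) h (sym e)
        case (inj₂ (inj₁ e))        = ι≢γ (x g') h (sym e)
        case (inj₂ (inj₂ (inj₁ e))) = h≢g (↑ʳ-injective n h g e)
        case (inj₂ (inj₂ (inj₂ e))) = h≢g' (↑ʳ-injective n h g' e)

      row₀ : colSum B U zero ≡ a xor b
      row₀ = trans (colSum-row₀ U) (xorSum-pair (λ h → U ! γ h) g g' g≢g' γ-off)

      row : ∀ i → colSum B U (suc i) ≡ ((c xor a) ∧ A i (x g)) xor ((d xor b) ∧ A i (x g'))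
      row i = begin
        colSum B U (suc i)
          ≡⟨ colSum-row U i ⟩
        colSum A (restrict U) i xor xorSum (λ h → U ! γ h ∧ A i (x h))
          ≡⟨ cong₂ _xor_
               (trans (xorSum-pair (λ s → restrict U ! s ∧ A i s) (x g) (x g') xg≢xg'
                         (λ s s≢xg s≢xg' → cong (_∧ A i s) (ι-off s s≢xg s≢xg')))
                      (cong₂ (λ u v → (u ∧ A i (x g)) xor (v ∧ A i (x g')))
                             (!-restrict U (x g)) (!-restrict U (x g'))))
               (xorSum-pair (λ h → U ! γ h ∧ A i (x h)) g g' g≢g'
                  (λ h h≢g h≢g' → cong (_∧ A i (x h)) (γ-off h h≢g h≢g'))) ⟩
        ((c ∧ A i (x g)) xor (d ∧ A i (x g'))) xor ((a ∧ A i (x g)) xor (b ∧ A i (x g')))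
          ≡⟨ interchange (c ∧ A i (x g)) (d ∧ A i (x g')) (a ∧ A i (x g)) (b ∧ A i (x g')) ⟩
        ((c ∧ A i (x g)) xor (a ∧ A i (x g))) xor ((d ∧ A i (x g')) xor (b ∧ A i (x g')))
          ≡⟨ sym (cong₂ _xor_ (∧-distribʳ-xor (A i (x g)) c a) (∧-distribʳ-xor (A i (x g')) d b)) ⟩
        ((c xor a) ∧ A i (x g)) xor ((d xor b) ∧ A i (x g')) ∎
        where open ≡-Reasoning

      -- In a cycle U ⊆ Q all four bits agree, by row 0 and the independence of x g, x g'.
      γ-bits : Cycle B U → a ≡ b
      γ-bits cU = xor-false⇒≡ a b (trans (sym row₀) (cU zero))

      x-bits : Cycle B U → c xor a ≡ false × d xor b ≡ false
      x-bits cU = independent-pair A indX (x∈imageSet x g) (x∈imageSet x g') xg≢xg' (c xor a) (d xor b)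
                    (λ i → trans (sym (row i)) (cU (suc i)))

      cycle-bits : Cycle B U → ∀ j → j ∈ Q → U ! j ≡ a
      cycle-bits cU j j∈Q with ∈Q⁻ j∈Q
      ... | inj₁ refl               = xor-false⇒≡ c a (proj₁ (x-bits cU))
      ... | inj₂ (inj₁ refl)        = trans (xor-false⇒≡ d b (proj₂ (x-bits cU))) (sym (γ-bits cU))
      ... | inj₂ (inj₂ (inj₁ refl)) = refl
      ... | inj₂ (inj₂ (inj₂ refl)) = sym (γ-bits cU)

    quad-circuit : Circuit B Q
    quad-circuit = minimal-cycle⇒circuit Q-cycle (γ g , γg∈Q) minimal
      where
      open Bits Q (λ j∈ → j∈) using (row₀; row)
      agree : ∀ {j k} → j ∈ Q → k ∈ Q → Q ! j xor Q ! k ≡ false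
      agree j∈ k∈ = cong₂ _xor_ (∈⇒! j∈) (∈⇒! k∈)
      Q-cycle : Cycle B Q
      Q-cycle zero    = trans row₀ (agree γg∈Q γg'∈Q)
      Q-cycle (suc i) = trans (row i) (cong₂ (λ u v → (u ∧ A i (x g)) xor (v ∧ A i (x g')))
                                             (agree ιxg∈Q γg∈Q) (agree ιxg'∈Q γg'∈Q))
      minimal : ∀ U → U ⊆ Q → Cycle B U → Nonempty U → Q ⊆ U
      minimal U U⊆Q cU (u , u∈U) {j} j∈Q =
        !⇒∈ (trans (cycle-bits cU j j∈Q) (trans (sym (cycle-bits cU u (U⊆Q u∈U))) (∈⇒! u∈U)))
        where open Bits U U⊆Q using (cycle-bits)

  lift-same-component : ∀ {s t} → SameComponent A s t → SameComponent B (ι s) (ι t)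
  lift-same-component (inj₁ refl)                 = inj₁ refl
  lift-same-component (inj₂ (C , circ , s∈C , t∈C)) =
    inj₂ (embed C , lift-circuit circ , ι∈embed s∈C , ι∈embed t∈C)

  -- If the component K of e avoids X, the copy of K in B is a
  -- 1-separation: every cycle Z of B meets it in a cycle, because the projection of Z
  -- to A meets K in a cycle of A and agrees with Z on K.
  component-separation : Fin m → ∀ e → (∀ g → ¬ SameComponent A e (x g)) →
    OneSeparation B (embed (component A e))
  component-separation g₀ e apart =
    splitting⇒separation B P (ι e , ι∈embed (∈component⁺ A (inj₁ refl)))
                             (γ g₀ , x∉p⇒x∈∁p (γ∉embed K g₀)) splits
    where
    K : Subset n
    K = component A e
    P : Subset (n + m)
    P = embed K
    x∉K : ∀ g → x g ∉ K
    x∉K g xg∈K = apart g (∈component⁻ A xg∈K)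
    splits : ∀ Z → Cycle B Z → Cycle B (Z ∩ P)
    splits Z cZ = cycle-without-Γ⁺ (Z ∩ P) (λ g γg∈ → γ∉embed K g (proj₂ (x∈p∩q⁻ Z P γg∈)))
      (subst (Cycle A) (sym restrict≡)
             (cycle-∩-closed A (component-closed A e) Z' (project-cycle Z cZ)))
      where
      Z' : Subset n
      Z' = restrict Z ⊕ image-sum (λ g → Z ! γ g)
      restrict≡ : restrict (Z ∩ P) ≡ Z' ∩ K
      restrict≡ = subset-ext bitwise
        where
        bitwise : ∀ s → restrict (Z ∩ P) ! s ≡ (Z' ∩ K) ! s
        bitwise s rewrite !-restrict (Z ∩ P) s | !-∩ Z P (ι s) | embed-ι K s | !-∩ Z' K s
                        | !-⊕ (restrict Z) (image-sum (λ g → Z ! γ g)) s | !-restrict Z s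
          with K ! s in ks
        ... | false = trans (∧-zeroʳ _) (sym (∧-zeroʳ _))
        ... | true with image-sum (λ g → Z ! γ g) ! s in is
        ...   | false = cong (_∧ true) (sym (xor-identityʳ _))
        ...   | true  = let (g , xg≡s) = image-sum-support _ s is
                        in ⊥-elim (x∉K g (subst (_∈ K) (sym xg≡s) (!⇒∈ ks)))

  components-meet-X : Connected B → Fin m → ∀ e → ∃[ g ] SameComponent A e (x g)
  components-meet-X connected g₀ e with any? (λ g → sameComponent? A e (x g))
  ... | yes found = found
  ... | no  apart = ⊥-elim (connected (_ , component-separation g₀ e (λ g same → apart (g , same))))

  -- With |X| = 1 the hypothesis would make A connected; otherwise each
  -- element lies on the side of ι (x g₀): elements of S via lifted circuits of A, and
  -- each x g, γ g via a circuit {x g₀, x g, γ g, ...} of the form Quad.Q.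
  module _ (injective : Injective _≡_ _≡_ x) (indX : Independent A (imageSet x)) where

    anchored : ∀ g₀ {g₁} → ¬ g₁ ≡ g₀ →
      ∀ g → ∃[ C ] (Circuit B C × ι (x g₀) ∈ C × ι (x g) ∈ C × γ g ∈ C)
    anchored g₀ {g₁} g₁≢g₀ g with g ≟ g₀
    ... | yes refl = Q , quad-circuit , ιxg∈Q , ιxg∈Q , γg∈Q
      where open Quad injective indX (λ e → g₁≢g₀ (sym e))
    ... | no  g≢g₀ = Q , quad-circuit , ιxg∈Q , ιxg'∈Q , γg'∈Q
      where open Quad injective indX (λ e → g≢g₀ (sym e))

    connected-if-components-meet-X : ¬ Connected A → Fin m →
      (∀ e → ∃[ g ] SameComponent A e (x g)) → Connected B
    connected-if-components-meet-X disconnected g₀ meet (P , sep) with any? (λ g → ¬? (g ≟ g₀))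
    ... | no  single = disconnected (common-component⇒connected A (x g₀) (λ e → to-anchor (meet e)))
      where
      to-anchor : ∀ {e} → ∃[ g ] SameComponent A e (x g) → SameComponent A e (x g₀)
      to-anchor (g , same) with g ≟ g₀
      ... | yes refl = same
      ... | no  g≢g₀ = ⊥-elim (single (g , g≢g₀))
    ... | yes (g₁ , g₁≢g₀) = separation-two-sided sep (ι (x g₀)) side
      where
      anchor-side : ∀ g → P ! ι (x g) ≡ P ! ι (x g₀) × P ! γ g ≡ P ! ι (x g₀)
      anchor-side g with anchored g₀ g₁≢g₀ g
      ... | C , circ , xg₀∈C , xg∈C , γg∈C =
        same-side B sep circ _ _ xg∈C xg₀∈C , same-side B sep circ _ _ γg∈C xg₀∈C
      side : ∀ j → P ! j ≡ P ! ι (x g₀)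
      side j with element-cases j
      ... | inj₁ (s , refl) = let (g , same) = meet s
                              in trans (same-component-side B sep (lift-same-component same)) (proj₁ (anchor-side g))
      ... | inj₂ (g , refl) = proj₂ (anchor-side g)

-- Theorem 2.7.
theorem2p7 : ∀ {r n m} (A : BinMatrix r n) (x : Fin m → Fin n) →
    Loopless A → Coloopless A →
    ¬ Connected A →
    0 < m → Injective _≡_ _≡_ x → Independent A (imageSet x) →
    Connected (gammaExt A x) ⇔ (∀ e → ∃[ g ] SameComponent A e (x g))
theorem2p7 A x _ _ disconnected m>0 injective indX =
  mk⇔ (λ connected → components-meet-X connected (fromℕ< m>0))
      (connected-if-components-meet-X injective indX disconnected (fromℕ< m>0))
  where open Extension A x
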